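{- Let $k\ge 2$, $j\ge 1$, and let $\Upsilon$ be a set of pairs $(\tau,u)$ with $\tau\in S_j$, $u\in\{0,\dots,k-1\}^j$ and $\mathrm{red}(u)=u$. Let $$N_k^{\Upsilon}(x,p,q,r,t)=\sum_{n\ge0}\frac{t^n}{[n]_{p,q}!}\sum_{(\sigma,w)\in C_k\wr S_n}q^{\mathrm{inv}(\sigma)}p^{\mathrm{coinv}(\sigma)}r^{\|w\|}x^{\Upsilon\text{ -nlap}(\sigma,w)},\qquad A_k^{\Upsilon}(p,q,r,t)=\sum_{n\ge0}\frac{t^n}{[n]_{p,q}!}\sum_{\substack{(\sigma,w)\in C_k\wr S_n\\ \Upsilon\text{ -mch}(\sigma,w)=0}}q^{\mathrm{inv}(\sigma)}p^{\mathrm{coinv}(\sigma)}r^{\|w\|}.$$ Then $$N_k^{\Upsilon}(x,p,q,r,t)=\frac{A_k^{\Upsilon}(p,q,r,t)}{1-x\left(1+([k]_rt-1)A_k^{\Upsilon}(p,q,r,t)\right)}.$$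
   Context: $C_k\wr S_n$ is identified with the set of pairs $(\sigma,w)$, $\sigma=\sigma_1\cdots\sigma_n\in S_n$, $w=w_1\cdots w_n\in\{0,\dots,k-1\}^n$ (one empty element for $n=0$). For a sequence of distinct integers, $\mathrm{red}$ replaces the $i$-th smallest entry by $i$; for a word of integers, $\mathrm{red}$ replaces the $i$-th smallest distinct value occurring by $i-1$. $(\sigma,w)$ has a $\Upsilon$-bi-match starting at position $i$ ($1\le i\le n-j+1$) if $(\mathrm{red}(\sigma_i\cdots\sigma_{i+j-1}),\mathrm{red}(w_i\cdots w_{i+j-1}))\in\Upsilon$; $\Upsilon\text{ -mch}(\sigma,w)$ is the number of such $i$. Two bi-matches starting at $i$ and $i'$ overlap if the position sets $\{i,\dots,i+j-1\}$ and $\{i',\dots,i'+j-1\}$ intersect; $\Upsilon\text{ -nlap}(\sigma,w)$ is the maximum number of pairwise non-overlapping $\Upsilon$-bi-matches in $(\sigma,w)$. $\mathrm{inv}(\sigma)=|\{a<b:\sigma_a>\sigma_b\}|$, $\mathrm{coinv}(\sigma)=|\{a<b:\sigma_a<\sigma_b\}|$, $\|w\|=w_1+\cdots+w_n$, $[n]_{p,q}=p^{n-1}+p^{n-2}q+\cdots+q^{n-1}$, $[n]_{p,q}!=[n]_{p,q}\cdots[1]_{p,q}$ ($[0]_{p,q}!=1$), $[k]_r=1+r+\cdots+r^{k-1}$. -}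

module Defs where

open import Level using (Level)
import Data.Nat
import Data.List
open import Data.Nat using (ℕ; zero; suc; _∸_; _<?_; _≤?_; _≤_)
import Data.Nat.Properties as ℕP
open import Data.Bool using (Bool; true; false; if_then_else_)
open import Data.List using (List; []; _∷_; map; concatMap; upTo; filter; length; take; drop; foldr; cartesianProduct; deduplicate)
import Data.List.Properties as LP
import Data.Product.Properties
open import Data.List.Relation.Unary.All using (All)
open import Data.List.Relation.Unary.Unique.Propositional using (Unique)
open import Data.List.Relation.Unary.Unique.DecPropositional ℕP._≟_ using (unique?)
open import Data.List.Membership.DecPropositional
  (Data.Product.Properties.≡-dec (LP.≡-dec ℕP._≟_) (LP.≡-dec ℕP._≟_))
  using (_∈?_)
open import Data.List.Membership.Propositional using (_∈_)
open import Data.Product using (_×_; _,_; proj₁; proj₂)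
open import Relation.Nullary using (does; ¬?)
open import Relation.Binary.PropositionalEquality using (_≡_)
open import Algebra.Bundles using (CommutativeRing)

words : ℕ → ℕ → List (List ℕ)
words m zero    = [] ∷ []
words m (suc n) = concatMap (λ a → map (a ∷_) (words m n)) (upTo m)

perms : ℕ → List (List ℕ)
perms n = filter unique? (map (map suc) (words n n))

wreath : ℕ → ℕ → List (List ℕ × List ℕ)
wreath k n = cartesianProduct (perms n) (words k n)

countP : (ℕ → Bool) → List ℕ → ℕ
countP P []       = 0
countP P (b ∷ s)  = (if P b then 1 else 0) Data.Nat.+ countP P s

lt : ℕ → ℕ → Bool
lt a b = does (a <? b)

inv : List ℕ → ℕ
inv []      = 0
inv (a ∷ s) = countP (λ b → lt b a) s Data.Nat.+ inv s

coinv : List ℕ → ℕ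
coinv []      = 0
coinv (a ∷ s) = countP (λ b → lt a b) s Data.Nat.+ coinv s

redP : List ℕ → List ℕ
redP s = map (λ a → suc (countP (λ b → lt b a) s)) s

-- red of a word: i-th smallest distinct value ↦ i-1
redW : List ℕ → List ℕ
redW w = map (λ a → length (deduplicate ℕP._≟_ (filter (λ b → b <? a) w))) w

Pattern : Set
Pattern = List (List ℕ × List ℕ)

-- Υ has a bi-match starting at (0-indexed) position i
matchAt : Pattern → ℕ → List ℕ → List ℕ → ℕ → Bool
matchAt Υ j σ w i =
  does ((redP (take j (drop i σ)) , redW (take j (drop i w))) ∈? Υ)

positions : ℕ → ℕ → List ℕ
positions j n = filter (λ i → (i Data.Nat.+ j) ≤? n) (upTo (suc n))

mch : Pattern → ℕ → List ℕ → List ℕ → ℕ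
mch Υ j σ w = countP (matchAt Υ j σ w) (positions j (length σ))

sublists : List ℕ → List (List ℕ)
sublists []      = [] ∷ []
sublists (a ∷ s) = map (a ∷_) (sublists s) Data.List.++ sublists s

allB : (ℕ → Bool) → List ℕ → Bool
allB P []      = true
allB P (a ∷ s) = if P a then allB P s else false

disjointWin : ℕ → ℕ → ℕ → Bool
disjointWin j i i' = if does ((i Data.Nat.+ j) ≤? i') then true else does ((i' Data.Nat.+ j) ≤? i)

nonOverlapping : Pattern → ℕ → List ℕ → List ℕ → List ℕ → Bool
nonOverlapping Υ j σ w []      = true
nonOverlapping Υ j σ w (i ∷ s) =
  if matchAt Υ j σ w i
  then (if allB (disjointWin j i) s then nonOverlapping Υ j σ w s else false)
  else false

maxL : List ℕ → ℕ
maxL = foldr Data.Nat._⊔_ 0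

nlap : Pattern → ℕ → List ℕ → List ℕ → ℕ
nlap Υ j σ w =
  maxL (map length
    (Data.List.filterᵇ (nonOverlapping Υ j σ w) (sublists (positions j (length σ)))))

‖_‖ : List ℕ → ℕ
‖ w ‖ = foldr Data.Nat._+_ 0 w

ValidPattern : ℕ → ℕ → Pattern → Set
ValidPattern k j Υ = All (λ τu →
    (proj₁ τu ∈ perms j) × (proj₂ τu ∈ words k j) × (redW (proj₂ τu) ≡ proj₂ τu)) Υ

module Series {c ℓ : Level} (R : CommutativeRing c ℓ) where
  open CommutativeRing R

  pow : Carrier → ℕ → Carrier
  pow a zero    = 1#
  pow a (suc n) = a * pow a n

  sumR : List Carrier → Carrier
  sumR = foldr _+_ 0#

  qint : Carrier → Carrier → ℕ → Carrier
  qint p q n = sumR (map (λ i → pow p (n ∸ suc i) * pow q i) (upTo n))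

  qfact : Carrier → Carrier → ℕ → Carrier
  qfact p q zero    = 1#
  qfact p q (suc n) = qint p q (suc n) * qfact p q n

  rint : Carrier → ℕ → Carrier
  rint r k = sumR (map (pow r) (upTo k))

  PS : Set c
  PS = ℕ → Carrier

  _≈PS_ : PS → PS → Set ℓ
  F ≈PS G = ∀ n → F n ≈ G n

  constPS : Carrier → PS
  constPS a zero    = a
  constPS a (suc n) = 0#

  tPS : PS
  tPS zero          = 0#
  tPS (suc zero)    = 1#
  tPS (suc (suc n)) = 0#

  _+PS_ : PS → PS → PS
  (F +PS G) n = F n + G n

  _-PS_ : PS → PS → PS
  (F -PS G) n = F n - G n

  _*PS_ : PS → PS → PS
  (F *PS G) n = sumR (map (λ i → F i * G (n ∸ i)) (upTo (suc n)))

  weightN : Pattern → ℕ → (x p q r : Carrier) → List ℕ × List ℕ → Carrier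
  weightN Υ j x p q r (σ , w) =
    pow q (inv σ) * pow p (coinv σ) * pow r ‖ w ‖ * pow x (nlap Υ j σ w)

  weightA : (p q r : Carrier) → List ℕ × List ℕ → Carrier
  weightA p q r (σ , w) = pow q (inv σ) * pow p (coinv σ) * pow r ‖ w ‖

  noMatch : Pattern → ℕ → List ℕ × List ℕ → Bool
  noMatch Υ j (σ , w) = does (mch Υ j σ w Data.Nat.≟ 0)

  -- N_k^Υ : coefficient of t^n is (1/[n]_{p,q}!) Σ_{(σ,w)} weight,
  -- where  d n  is a given inverse of [n]_{p,q}!
  Nser : ℕ → Pattern → ℕ → (x p q r : Carrier) → (d : ℕ → Carrier) → PS
  Nser k Υ j x p q r d n = d n * sumR (map (weightN Υ j x p q r) (wreath k n))

  Aser : ℕ → Pattern → ℕ → (p q r : Carrier) → (d : ℕ → Carrier) → PS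
  Aser k Υ j p q r d n =
    d n * sumR (map (weightA p q r) (Data.List.filterᵇ (noMatch Υ j) (wreath k n)))

-- Cut (σ, w) right after its first bi-match, in the order of right ends. If there is none, (σ, w)
-- is counted by A. Otherwise the reduced prefix is a "minimal" object, whose only bi-matches end at
-- its last position, and by the greedy argument nlap(σ, w) = 1 + nlap of the reduced suffix. The
-- weight q^inv p^coinv r^‖w‖ of (σ, w) splits over such a cut as the product of the weights of the
-- two reduced pieces times that of a shuffle, and the shuffles of sizes i and m add up to the
-- p,q-binomial coefficient, so with the [n]_{p,q}! normalisation N = A + x M N, where M is the series
-- of minimal objects. Appending a letter (in [k]_r colours, at any relative value) to a match-free
-- object gives a match-free or a minimal one, so M = 1 + ([k]_r t - 1) A; hence N (1 - x M) = A.

module Submission where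

open import Defs
open import Level using (Level; _⊔_)
open import Algebra.Bundles using (CommutativeRing)
import Algebra.Solver.CommutativeMonoid as CommutativeMonoidSolver
open import Data.Bool using (Bool; true; false; _∧_; not; if_then_else_; T; T?)
import Data.Bool.Properties as Bool
open import Data.Empty using (⊥-elim)
open import Data.List using (List; []; _∷_; map; upTo; applyUpTo; _++_; length; take; drop; filter; filterᵇ; concatMap; cartesianProduct; cartesianProductWith)
import Data.List.Properties as List
open import Data.List.Membership.Propositional using (_∈_; _∉_)
open import Data.List.Membership.Propositional.Properties
  using (∈-map⁺; ∈-map⁻; ∈-filter⁺; ∈-filter⁻; ∈-++⁻; ∈-++⁺ˡ; ∈-++⁺ʳ; ∈-upTo⁺; ∈-upTo⁻;
         ∈-cartesianProductWith⁺; ∈-cartesianProductWith⁻; ∈-cartesianProduct⁺; ∈-cartesianProduct⁻)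
open import Data.List.Membership.Propositional.Properties.WithK using (unique∧set⇒bag)
open import Data.List.Relation.Binary.BagAndSetEquality using (∼bag⇒↭)
open import Data.List.Relation.Binary.Permutation.Propositional using (_↭_; ↭⇒↭ₛ′)
import Data.List.Relation.Binary.Permutation.Propositional.Properties as ↭
import Data.List.Relation.Binary.Permutation.Setoid.Properties as ↭ₛ
open import Data.List.Relation.Unary.All as All using (All; []; _∷_)
import Data.List.Relation.Unary.All.Properties as Allₚ
open import Data.List.Relation.Unary.AllPairs as AllPairs using (AllPairs; []; _∷_)
import Data.List.Relation.Unary.AllPairs.Properties as AllPairsₚ
open import Data.List.Relation.Unary.Any using (here; there; any?)
open import Data.List.Relation.Unary.Unique.Propositional using (Unique)
import Data.List.Relation.Unary.Unique.Propositional.Properties as Unique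
open import Data.Nat as ℕ using (ℕ; zero; suc; _∸_; _≤_; _<_; z≤n; s≤s; pred; _<?_; _≤?_; _≟_)
import Data.Nat.Properties as ℕ
open import Data.List.Relation.Unary.Unique.DecPropositional ℕ._≟_ using (unique?)
open import Data.Product using (_×_; _,_; proj₁; proj₂; Σ-syntax; ∃)
import Data.Product.Properties as Product
open import Data.List.Membership.DecPropositional (Product.≡-dec (List.≡-dec ℕ._≟_) (List.≡-dec ℕ._≟_)) using (_∈?_)
open import Data.Sum using (_⊎_; inj₁; inj₂)
open import Data.Unit using (tt)
open import Function using (_∘_)
open import Function.Bundles using (_⇔_; mk⇔; Equivalence)
open import Function.Construct.Composition using (_⇔-∘_)
open import Relation.Binary.Definitions using (tri<; tri≈; tri>)
import Relation.Binary.PropositionalEquality as ≡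
open import Relation.Binary.PropositionalEquality using (_≡_; _≢_; cong; cong₂; subst; module ≡-Reasoning)
open import Relation.Nullary using (¬_; Dec; yes; no; does)
open import Relation.Nullary.Decidable using (dec-true; dec-false; does-⇔)

module Counting where
  open import Relation.Binary.PropositionalEquality using (refl; sym)
  open import Data.Nat using (_+_)

  [_]ᵇ : Bool → ℕ
  [ b ]ᵇ = if b then 1 else 0

  countP-map : ∀ P (g : ℕ → ℕ) L → countP P (map g L) ≡ countP (λ b → P (g b)) L
  countP-map P g []      = refl
  countP-map P g (a ∷ L) = cong ([ P (g a) ]ᵇ +_) (countP-map P g L)

  countP-cong : ∀ P Q L → (∀ b → b ∈ L → P b ≡ Q b) → countP P L ≡ countP Q L
  countP-cong P Q []      P≡Q = refl
  countP-cong P Q (a ∷ L) P≡Q =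
    cong₂ (λ x y → [ x ]ᵇ + y) (P≡Q a (here refl)) (countP-cong P Q L (λ b b∈ → P≡Q b (there b∈)))

  countP-all : ∀ P L → All (λ b → P b ≡ true) L → countP P L ≡ length L
  countP-all P []      []          = refl
  countP-all P (a ∷ L) (Pa ∷ PL) rewrite Pa = cong suc (countP-all P L PL)

  countP-none : ∀ P L → All (λ b → P b ≡ false) L → countP P L ≡ 0
  countP-none P []      []          = refl
  countP-none P (a ∷ L) (Pa ∷ PL) rewrite Pa = countP-none P L PL

  countP-none⁻ : ∀ P L → countP P L ≡ 0 → All (λ b → P b ≡ false) L
  countP-none⁻ P []      _ = []
  countP-none⁻ P (a ∷ L) eq with P a in Pa
  ... | false = Pa ∷ countP-none⁻ P L eq

  private
    [_]ᵇ-mono : ∀ x y → (x ≡ true → y ≡ true) → [ x ]ᵇ ≤ [ y ]ᵇ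
    [ true  ]ᵇ-mono y x⇒y rewrite x⇒y refl = ℕ.≤-refl
    [ false ]ᵇ-mono y x⇒y = z≤n

  countP-mono : ∀ P Q L → (∀ b → P b ≡ true → Q b ≡ true) → countP P L ≤ countP Q L
  countP-mono P Q []      P⇒Q = z≤n
  countP-mono P Q (a ∷ L) P⇒Q = ℕ.+-mono-≤ ([ P a ]ᵇ-mono (Q a) (P⇒Q a)) (countP-mono P Q L P⇒Q)

  countP-mono-< : ∀ P Q L b → b ∈ L → P b ≡ false → Q b ≡ true → (∀ c → P c ≡ true → Q c ≡ true) →
                  countP P L < countP Q L
  countP-mono-< P Q (a ∷ L) b (here refl) Pb Qb P⇒Q rewrite Pb | Qb = s≤s (countP-mono P Q L P⇒Q)
  countP-mono-< P Q (a ∷ L) b (there b∈)  Pb Qb P⇒Q =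
    ℕ.+-mono-≤-< ([ P a ]ᵇ-mono (Q a) (P⇒Q a)) (countP-mono-< P Q L b b∈ Pb Qb P⇒Q)

  lt-true : ∀ {a b} → a < b → lt a b ≡ true
  lt-true {a} {b} = dec-true (a <? b)

  lt-false : ∀ {a b} → b ≤ a → lt a b ≡ false
  lt-false {a} {b} b≤a = dec-false (a <? b) (λ a<b → ℕ.<⇒≱ a<b b≤a)

  lt-true⁻ : ∀ {a b} → lt a b ≡ true → a < b
  lt-true⁻ {a} {b} eq = ℕ.<ᵇ⇒< a b (subst T (sym eq) tt)

module Insertion where
  open Counting
  open import Relation.Binary.PropositionalEquality using (refl; sym; trans)
  open import Data.Nat using (_+_)
  open import Algebra.Properties.CommutativeSemigroup ℕ.+-commutativeSemigroup using (x∙yz≈y∙xz)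
  open ≡-Reasoning

  insertAt : ℕ → ℕ → List ℕ → List ℕ
  insertAt zero    x L       = x ∷ L
  insertAt (suc t) x []      = x ∷ []
  insertAt (suc t) x (a ∷ L) = a ∷ insertAt t x L

  length-insertAt : ∀ t x L → length (insertAt t x L) ≡ suc (length L)
  length-insertAt zero    x L       = refl
  length-insertAt (suc t) x []      = refl
  length-insertAt (suc t) x (a ∷ L) = cong suc (length-insertAt t x L)

  map-insertAt : ∀ (f : ℕ → ℕ) t x L → map f (insertAt t x L) ≡ insertAt t (f x) (map f L)
  map-insertAt f zero    x L       = refl
  map-insertAt f (suc t) x []      = refl
  map-insertAt f (suc t) x (a ∷ L) = cong (f a ∷_) (map-insertAt f t x L)

  take-insertAt-≤ : ∀ t i x L → t ≤ i → take (suc i) (insertAt t x L) ≡ insertAt t x (take i L)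
  take-insertAt-≤ zero    i       x L       t≤i       = refl
  take-insertAt-≤ (suc t) (suc i) x []      t≤i       = refl
  take-insertAt-≤ (suc t) (suc i) x (a ∷ L) (s≤s t≤i) = cong (a ∷_) (take-insertAt-≤ t i x L t≤i)

  drop-insertAt-≤ : ∀ t i x L → t ≤ i → drop (suc i) (insertAt t x L) ≡ drop i L
  drop-insertAt-≤ zero    i       x L       t≤i       = refl
  drop-insertAt-≤ (suc t) (suc i) x []      t≤i       = refl
  drop-insertAt-≤ (suc t) (suc i) x (a ∷ L) (s≤s t≤i) = drop-insertAt-≤ t i x L t≤i

  take-insertAt-+ : ∀ i t x L → i ≤ length L → take i (insertAt (i + t) x L) ≡ take i L
  take-insertAt-+ zero    t x L       i≤ = refl
  take-insertAt-+ (suc i) t x (a ∷ L) (s≤s i≤) = cong (a ∷_) (take-insertAt-+ i t x L i≤)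

  drop-insertAt-+ : ∀ i t x L → i ≤ length L → drop i (insertAt (i + t) x L) ≡ insertAt t x (drop i L)
  drop-insertAt-+ zero    t x L       i≤ = refl
  drop-insertAt-+ (suc i) t x (a ∷ L) (s≤s i≤) = drop-insertAt-+ i t x L i≤

  All-insertAt⁻ : ∀ {P : ℕ → Set} t x L → All P (insertAt t x L) → P x × All P L
  All-insertAt⁻ zero    x L       (px ∷ pL) = px , pL
  All-insertAt⁻ (suc t) x []      (px ∷ []) = px , []
  All-insertAt⁻ (suc t) x (a ∷ L) (pa ∷ pL) with All-insertAt⁻ t x L pL
  ... | px , pL′ = px , (pa ∷ pL′)

  All-insertAt⁺ : ∀ {P : ℕ → Set} t x L → P x → All P L → All P (insertAt t x L)
  All-insertAt⁺ zero    x L       px pL        = px ∷ pL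
  All-insertAt⁺ (suc t) x []      px []        = px ∷ []
  All-insertAt⁺ (suc t) x (a ∷ L) px (pa ∷ pL) = pa ∷ All-insertAt⁺ t x L px pL

  Unique-insertAt⁻ : ∀ t x L → Unique (insertAt t x L) → Unique L × x ∉ L
  Unique-insertAt⁻ zero    x L       (x∉ ∷ L!) = L! , λ x∈ → All.lookup x∉ x∈ refl
  Unique-insertAt⁻ (suc t) x []      _          = [] , λ ()
  Unique-insertAt⁻ (suc t) x (a ∷ L) (a∉ ∷ L!) with Unique-insertAt⁻ t x L L! | All-insertAt⁻ t x L a∉
  ... | L′! , x∉L | a≢x , a∉L = (a∉L ∷ L′!) , λ { (here x≡a) → a≢x (sym x≡a) ; (there x∈) → x∉L x∈ }

  Unique-insertAt⁺ : ∀ t x L → Unique L → x ∉ L → Unique (insertAt t x L)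
  Unique-insertAt⁺ zero    x L       L!         x∉L = All.tabulate (λ y∈ x≡y → x∉L (subst (_∈ L) (sym x≡y) y∈)) ∷ L!
  Unique-insertAt⁺ (suc t) x []      L!         x∉L = [] ∷ []
  Unique-insertAt⁺ (suc t) x (a ∷ L) (a∉ ∷ L!) x∉L =
    All-insertAt⁺ t x L (λ a≡x → x∉L (here (sym a≡x))) a∉ ∷ Unique-insertAt⁺ t x L L! (λ x∈ → x∉L (there x∈))

  insertAt-injective : ∀ t t′ x L L′ → x ∉ L → x ∉ L′ → t ≤ length L → t′ ≤ length L′ →
                       insertAt t x L ≡ insertAt t′ x L′ → t ≡ t′ × L ≡ L′
  insertAt-injective zero    zero     x L       L′        _   _    _       _        eq = refl , List.∷-injectiveʳ eq
  insertAt-injective zero    (suc t′) x L       []        _   _    _       ()       eq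
  insertAt-injective zero    (suc t′) x L       (a ∷ L′)  _   x∉L′ _       _        eq = ⊥-elim (x∉L′ (here (List.∷-injectiveˡ eq)))
  insertAt-injective (suc t) t′       x []      L′        _   _    ()      _        eq
  insertAt-injective (suc t) zero     x (a ∷ L) L′        x∉L _    _       _        eq = ⊥-elim (x∉L (here (sym (List.∷-injectiveˡ eq))))
  insertAt-injective (suc t) (suc t′) x (a ∷ L) []        _   _    _       ()       eq
  insertAt-injective (suc t) (suc t′) x (a ∷ L) (b ∷ L′) x∉L x∉L′ (s≤s t≤) (s≤s t′≤) eq with List.∷-injective eq
  ... | refl , eq′ with insertAt-injective t t′ x L L′ (λ x∈ → x∉L (there x∈)) (λ x∈ → x∉L′ (there x∈)) t≤ t′≤ eq′
  ...   | refl , refl = refl , refl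

  ∈⇒insertAt : ∀ {x} L → x ∈ L → Σ[ t ∈ ℕ ] Σ[ L′ ∈ List ℕ ] L ≡ insertAt t x L′ × t ≤ length L′
  ∈⇒insertAt (a ∷ L) (here x≡a) = 0 , L , cong (_∷ L) (sym x≡a) , z≤n
  ∈⇒insertAt (a ∷ L) (there x∈) with ∈⇒insertAt L x∈
  ... | t , L′ , eq , t≤ = suc t , a ∷ L′ , cong (a ∷_) eq , s≤s t≤

  countP-insertAt : ∀ P t x L → countP P (insertAt t x L) ≡ [ P x ]ᵇ + countP P L
  countP-insertAt P zero    x L       = refl
  countP-insertAt P (suc t) x []      = refl
  countP-insertAt P (suc t) x (a ∷ L) = begin
    [ P a ]ᵇ + countP P (insertAt t x L) ≡⟨ cong ([ P a ]ᵇ +_) (countP-insertAt P t x L) ⟩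
    [ P a ]ᵇ + ([ P x ]ᵇ + countP P L)   ≡⟨ x∙yz≈y∙xz [ P a ]ᵇ [ P x ]ᵇ (countP P L) ⟩
    [ P x ]ᵇ + ([ P a ]ᵇ + countP P L)   ∎

  redP-insertAt : ∀ t x L → All (_< x) L → redP (insertAt t x L) ≡ insertAt t (suc (length L)) (redP L)
  redP-insertAt t x L L<x = trans (map-insertAt rank t x L) (cong₂ (insertAt t) rank-x rank-L)
    where
    rank : ℕ → ℕ
    rank a = suc (countP (λ b → lt b a) (insertAt t x L))
    rank-x : rank x ≡ suc (length L)
    rank-x = cong suc (trans (countP-insertAt (λ b → lt b x) t x L)
               (cong₂ (λ b n → [ b ]ᵇ + n) (lt-false {x} ℕ.≤-refl) (countP-all (λ b → lt b x) L (All.map lt-true L<x))))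
    rank-L : map rank L ≡ redP L
    rank-L = List.map-cong-local (All.map (λ {a} a<x → cong suc (trans (countP-insertAt (λ b → lt b a) t x L)
               (cong (λ b → [ b ]ᵇ + countP (λ b → lt b a) L) (lt-false (ℕ.<⇒≤ a<x))))) L<x)

  inv-insertAt : ∀ t x L → All (_< x) L → t ≤ length L → inv (insertAt t x L) ≡ inv L + (length L ∸ t)
  inv-insertAt zero x L L<x _ =
    trans (cong (_+ inv L) (countP-all (λ b → lt b x) L (All.map lt-true L<x))) (ℕ.+-comm (length L) (inv L))
  inv-insertAt (suc t) x (a ∷ L) (a<x ∷ L<x) (s≤s t≤) = begin
    countP (λ b → lt b a) (insertAt t x L) + inv (insertAt t x L)
      ≡⟨ cong₂ _+_ (countP-insertAt (λ b → lt b a) t x L) (inv-insertAt t x L L<x t≤) ⟩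
    ([ lt x a ]ᵇ + countP (λ b → lt b a) L) + (inv L + (length L ∸ t))
      ≡⟨ cong (λ b → ([ b ]ᵇ + countP (λ b → lt b a) L) + (inv L + (length L ∸ t))) (lt-false (ℕ.<⇒≤ a<x)) ⟩
    countP (λ b → lt b a) L + (inv L + (length L ∸ t))
      ≡⟨ ℕ.+-assoc (countP (λ b → lt b a) L) (inv L) (length L ∸ t) ⟨
    (countP (λ b → lt b a) L + inv L) + (length L ∸ t) ∎

  coinv-insertAt : ∀ t x L → All (_< x) L → t ≤ length L → coinv (insertAt t x L) ≡ coinv L + t
  coinv-insertAt zero x L L<x _ =
    trans (cong (_+ coinv L) (countP-none (λ b → lt x b) L (All.map (λ b<x → lt-false (ℕ.<⇒≤ b<x)) L<x)))
          (sym (ℕ.+-identityʳ (coinv L)))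
  coinv-insertAt (suc t) x (a ∷ L) (a<x ∷ L<x) (s≤s t≤) = begin
    countP (λ b → lt a b) (insertAt t x L) + coinv (insertAt t x L)
      ≡⟨ cong₂ _+_ (countP-insertAt (λ b → lt a b) t x L) (coinv-insertAt t x L L<x t≤) ⟩
    ([ lt a x ]ᵇ + countP (λ b → lt a b) L) + (coinv L + t)
      ≡⟨ cong (λ b → ([ b ]ᵇ + countP (λ b → lt a b) L) + (coinv L + t)) (lt-true a<x) ⟩
    suc (countP (λ b → lt a b) L + (coinv L + t))
      ≡⟨ cong suc (ℕ.+-assoc (countP (λ b → lt a b) L) (coinv L) t) ⟨
    suc ((countP (λ b → lt a b) L + coinv L) + t)
      ≡⟨ ℕ.+-suc (countP (λ b → lt a b) L + coinv L) t ⟨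
    (countP (λ b → lt a b) L + coinv L) + suc t ∎

module Enumeration where
  open import Relation.Binary.PropositionalEquality using (refl; sym; trans)
  open Insertion

  InRange : ℕ → ℕ → Set
  InRange n a = 0 < a × a ≤ n

  IsPerm : ℕ → List ℕ → Set
  IsPerm n σ = length σ ≡ n × All (InRange n) σ × Unique σ

  private
    InRange-pred : ∀ {n} L → All (InRange (suc n)) L → suc n ∉ L → All (InRange n) L
    InRange-pred L inR n+1∉L = All.zipWith (λ { ((0<a , a≤) , a≢) → 0<a , ℕ.≤-pred (ℕ.≤∧≢⇒< a≤ (λ a≡ → a≢ (sym a≡))) })
                                            (inR , Allₚ.¬Any⇒All¬ L n+1∉L)

  Unique∧InRange⇒length≤ : ∀ n L → Unique L → All (InRange n) L → length L ≤ n
  Unique∧InRange⇒length≤ zero    []      _  _                     = z≤n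
  Unique∧InRange⇒length≤ zero    (a ∷ L) _  ((0<a , a≤0) ∷ _)      = ⊥-elim (ℕ.<⇒≱ 0<a a≤0)
  Unique∧InRange⇒length≤ (suc n) L       L! inR with any? (suc n ≟_) L
  ... | no n+1∉L = ℕ.m≤n⇒m≤1+n (Unique∧InRange⇒length≤ n L L! (InRange-pred L inR n+1∉L))
  ... | yes n+1∈L with ∈⇒insertAt L n+1∈L
  ...   | t , L′ , refl , _ with Unique-insertAt⁻ t (suc n) L′ L! | All-insertAt⁻ t (suc n) L′ inR
  ...     | L′! , n+1∉L′ | _ , inR′ =
    subst (_≤ suc n) (sym (length-insertAt t (suc n) L′))
          (s≤s (Unique∧InRange⇒length≤ n L′ L′! (InRange-pred L′ inR′ n+1∉L′)))

  words-suc : ∀ m n → words m (suc n) ≡ cartesianProductWith _∷_ (upTo m) (words m n)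
  words-suc m n = concatMap≡cartesianProductWith (upTo m)
    where
    concatMap≡cartesianProductWith : ∀ xs → concatMap (λ a → map (a ∷_) (words m n)) xs ≡ cartesianProductWith _∷_ xs (words m n)
    concatMap≡cartesianProductWith []       = refl
    concatMap≡cartesianProductWith (x ∷ xs) = cong (map (x ∷_) (words m n) ++_) (concatMap≡cartesianProductWith xs)

  ∈-words⁻ : ∀ m n u → u ∈ words m n → length u ≡ n × All (_< m) u
  ∈-words⁻ m zero    u (here refl) = refl , []
  ∈-words⁻ m (suc n) u u∈ with ∈-cartesianProductWith⁻ _∷_ (upTo m) (words m n) (subst (u ∈_) (words-suc m n) u∈)
  ... | a , w , a∈ , w∈ , refl with ∈-words⁻ m n w w∈
  ...   | len , w<m = cong suc len , (∈-upTo⁻ a∈ ∷ w<m)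

  ∈-words⁺ : ∀ m n u → length u ≡ n → All (_< m) u → u ∈ words m n
  ∈-words⁺ m zero    []      refl []          = here refl
  ∈-words⁺ m (suc n) (a ∷ u) len  (a<m ∷ u<m) =
    subst ((a ∷ u) ∈_) (sym (words-suc m n))
          (∈-cartesianProductWith⁺ _∷_ (∈-upTo⁺ a<m) (∈-words⁺ m n u (ℕ.suc-injective len) u<m))

  words-unique : ∀ m n → Unique (words m n)
  words-unique m zero    = [] ∷ []
  words-unique m (suc n) = subst Unique (sym (words-suc m n))
    (Unique.cartesianProductWith⁺ _∷_ List.∷-injective (Unique.upTo⁺ m) (words-unique m n))

  ∈-perms⁻ : ∀ n σ → σ ∈ perms n → IsPerm n σ
  ∈-perms⁻ n σ σ∈ with ∈-filter⁻ unique? {xs = map (map suc) (words n n)} σ∈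
  ... | σ∈′ , σ! with ∈-map⁻ (map suc) σ∈′
  ...   | u , u∈ , refl with ∈-words⁻ n n u u∈
  ...     | len , u<n = trans (List.length-map suc u) len , All-suc u u<n , σ!
    where
    All-suc : ∀ u → All (_< n) u → All (InRange n) (map suc u)
    All-suc []      []          = []
    All-suc (b ∷ u) (b<n ∷ u<n) = (s≤s z≤n , b<n) ∷ All-suc u u<n

  private
    InRange⇒map-suc : ∀ n σ → All (InRange n) σ → Σ[ u ∈ List ℕ ] σ ≡ map suc u × All (_< n) u
    InRange⇒map-suc n []          []                = [] , refl , []
    InRange⇒map-suc n (suc a ∷ σ) ((_ , a<) ∷ inR) with InRange⇒map-suc n σ inR
    ... | u , refl , u<n = a ∷ u , refl , (a< ∷ u<n)

  ∈-perms⁺ : ∀ n σ → IsPerm n σ → σ ∈ perms n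
  ∈-perms⁺ n σ (len , inR , σ!) with InRange⇒map-suc n σ inR
  ... | u , refl , u<n =
    ∈-filter⁺ unique? (∈-map⁺ (map suc) (∈-words⁺ n n u (trans (sym (List.length-map suc u)) len) u<n)) σ!

  perms-unique : ∀ n → Unique (perms n)
  perms-unique n = Unique.filter⁺ unique? (Unique.map⁺ (List.map-injective ℕ.suc-injective) (words-unique n n))

  n+1∉perm : ∀ n σ → All (InRange n) σ → suc n ∉ σ
  n+1∉perm n σ inR n+1∈ = ℕ.<-irrefl refl (proj₂ (All.lookup inR n+1∈))

  insertMax : ℕ → List ℕ × ℕ → List ℕ
  insertMax n (σ , t) = insertAt t (suc n) σ

  insertMax-∈ : ∀ n y → y ∈ cartesianProduct (perms n) (upTo (suc n)) → insertMax n y ∈ perms (suc n)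
  insertMax-∈ n (σ , t) y∈ with ∈-cartesianProduct⁻ (perms n) (upTo (suc n)) y∈
  ... | σ∈ , t∈ with ∈-perms⁻ n σ σ∈
  ...   | len , inR , σ! = ∈-perms⁺ (suc n) _
    (trans (length-insertAt t (suc n) σ) (cong suc len) ,
     All-insertAt⁺ t (suc n) σ (s≤s z≤n , ℕ.≤-refl) (All.map (λ { (0<a , a≤n) → 0<a , ℕ.m≤n⇒m≤1+n a≤n }) inR) ,
     Unique-insertAt⁺ t (suc n) σ σ! (n+1∉perm n σ inR))

  insertMax-surjective : ∀ n σ → σ ∈ perms (suc n) →
    ∃ λ y → y ∈ cartesianProduct (perms n) (upTo (suc n)) × σ ≡ insertMax n y
  insertMax-surjective n σ σ∈ with ∈-perms⁻ (suc n) σ σ∈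
  ... | len , inR , σ! with any? (suc n ≟_) σ
  ...   | no n+1∉σ = ⊥-elim (ℕ.<-irrefl refl (subst (_≤ n) len
                       (Unique∧InRange⇒length≤ n σ σ! (InRange-pred σ inR n+1∉σ))))
  ...   | yes n+1∈σ with ∈⇒insertAt σ n+1∈σ
  ...     | t , σ′ , refl , t≤ with Unique-insertAt⁻ t (suc n) σ′ σ! | All-insertAt⁻ t (suc n) σ′ inR
  ...       | σ′! , n+1∉σ′ | _ , inR′ =
    (σ′ , t) , ∈-cartesianProduct⁺ (∈-perms⁺ n σ′ (len′ , InRange-pred σ′ inR′ n+1∉σ′ , σ′!))
                                   (∈-upTo⁺ (s≤s (subst (t ≤_) len′ t≤))) , refl
    where
    len′ : length σ′ ≡ n
    len′ = ℕ.suc-injective (trans (sym (length-insertAt t (suc n) σ′)) len)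

  insertMax-injective : ∀ n y y′ → y ∈ cartesianProduct (perms n) (upTo (suc n)) →
    y′ ∈ cartesianProduct (perms n) (upTo (suc n)) → insertMax n y ≡ insertMax n y′ → y ≡ y′
  insertMax-injective n (σ , t) (σ′ , t′) y∈ y′∈ eq
    with ∈-cartesianProduct⁻ (perms n) (upTo (suc n)) y∈ | ∈-cartesianProduct⁻ (perms n) (upTo (suc n)) y′∈
  ... | σ∈ , t∈ | σ′∈ , t′∈ with ∈-perms⁻ n σ σ∈ | ∈-perms⁻ n σ′ σ′∈
  ...   | len , inR , _ | len′ , inR′ , _
    with insertAt-injective t t′ (suc n) σ σ′ (n+1∉perm n σ inR) (n+1∉perm n σ′ inR′)
           (subst (t ≤_) (sym len) (ℕ.≤-pred (∈-upTo⁻ t∈))) (subst (t′ ≤_) (sym len′) (ℕ.≤-pred (∈-upTo⁻ t′∈))) eq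
  ...     | refl , refl = refl

module Positions where
  open import Relation.Binary.PropositionalEquality using (refl; sym; trans)
  open import Data.Nat using (_+_)

  range : ℕ → ℕ → List ℕ
  range a zero    = []
  range a (suc N) = a ∷ range (suc a) N

  upTo≡range : ∀ N → upTo N ≡ range 0 N
  upTo≡range N = shift (λ i → i) 0 N (λ i → refl)
    where
    shift : ∀ (f : ℕ → ℕ) a N → (∀ i → f i ≡ a + i) → applyUpTo f N ≡ range a N
    shift f a zero    f≡ = refl
    shift f a (suc N) f≡ = cong₂ _∷_ (trans (f≡ 0) (ℕ.+-identityʳ a))
                                     (shift (λ i → f (suc i)) (suc a) N (λ i → trans (f≡ (suc i)) (ℕ.+-suc a i)))

  InInterval : ℕ → ℕ → ℕ → Set
  InInterval a N x = a ≤ x × x < a + N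

  private
    InInterval-suc : ∀ {a N x} → InInterval (suc a) N x → InInterval a (suc N) x
    InInterval-suc {a} {N} {x} (a<x , x<) = ℕ.<⇒≤ a<x , subst (x <_) (sym (ℕ.+-suc a N)) x<

    InInterval-pred : ∀ {a N x} → a < x → InInterval a (suc N) x → InInterval (suc a) N x
    InInterval-pred {a} {N} {x} a<x (_ , x<) = a<x , subst (x <_) (ℕ.+-suc a N) x<

    InInterval-head : ∀ a N → InInterval a (suc N) a
    InInterval-head a N = ℕ.≤-refl , subst (a <_) (sym (ℕ.+-suc a N)) (s≤s (ℕ.m≤m+n a N))

  ∈-range⁻ : ∀ {x} a N → x ∈ range a N → InInterval a N x
  ∈-range⁻ a (suc N) (here refl) = InInterval-head a N
  ∈-range⁻ a (suc N) (there x∈)  = InInterval-suc (∈-range⁻ (suc a) N x∈)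

  ∈-range⁺ : ∀ {x} a N → InInterval a N x → x ∈ range a N
  ∈-range⁺ {x} a zero    (a≤x , x<) = ⊥-elim (ℕ.<⇒≱ x< (subst (_≤ x) (sym (ℕ.+-identityʳ a)) a≤x))
  ∈-range⁺ {x} a (suc N) (a≤x , x<) with x ≟ a
  ... | yes refl = here refl
  ... | no  x≢a  = there (∈-range⁺ (suc a) N (InInterval-pred (ℕ.≤∧≢⇒< a≤x (λ a≡x → x≢a (sym a≡x))) (a≤x , x<)))

  positions≡range : ∀ j n → positions j n ≡ range 0 (suc n ∸ j)
  positions≡range j n = trans (cong (filter fits?) (upTo≡range (suc n))) (filter-range 0 (suc n) refl)
    where
    fits? = λ i → (i + j) ≤? n
    M = suc n ∸ j
    filter-range : ∀ a N → a + N ≡ suc n → filter fits? (range a N) ≡ range a (M ∸ a)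
    filter-range a zero a+0≡ = sym (cong (range a) (ℕ.m≤n⇒m∸n≡0
      (subst (M ≤_) (sym (trans (sym (ℕ.+-identityʳ a)) a+0≡)) (ℕ.m∸n≤m (suc n) j))))
    filter-range a (suc N) a+N+1≡ with (a + j) ≤? n
    ... | yes a+j≤n = trans (List.filter-accept fits? a+j≤n)
            (trans (cong (a ∷_) (filter-range (suc a) N (trans (sym (ℕ.+-suc a N)) a+N+1≡)))
                   (cong (range a) (sym (ℕ.+-∸-assoc 1 (ℕ.m+n≤o⇒m≤o∸n (suc a) (s≤s a+j≤n)))) ))
    ... | no  a+j≰n = trans (List.filter-reject fits? a+j≰n)
            (trans (filter-range (suc a) N (trans (sym (ℕ.+-suc a N)) a+N+1≡))
                   (trans (cong (range (suc a)) (ℕ.m≤n⇒m∸n≡0 (ℕ.≤-trans M≤a (ℕ.n≤1+n a))))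
                          (sym (cong (range a) (ℕ.m≤n⇒m∸n≡0 M≤a)))))
      where
      M≤a : M ≤ a
      M≤a = ℕ.≤-trans (ℕ.∸-monoˡ-≤ j (ℕ.≰⇒> a+j≰n)) (ℕ.≤-reflexive (ℕ.m+n∸n≡m a j))

  ∈-positions⁻ : ∀ {m} j n → m ∈ positions j n → m + j ≤ n
  ∈-positions⁻ j n m∈ = proj₂ (∈-filter⁻ (λ i → (i + j) ≤? n) {xs = upTo (suc n)} m∈)

  ∈-positions⁺ : ∀ {m} j n → m + j ≤ n → m ∈ positions j n
  ∈-positions⁺ {m} j n m+j≤n =
    ∈-filter⁺ (λ i → (i + j) ≤? n) (∈-upTo⁺ (s≤s (ℕ.≤-trans (ℕ.m≤m+n m j) m+j≤n))) m+j≤n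

  []∈sublists : ∀ xs → [] ∈ sublists xs
  []∈sublists []      = here refl
  []∈sublists (a ∷ s) = ∈-++⁺ʳ (map (a ∷_) (sublists s)) ([]∈sublists s)

  ∈-sublists-range⁻ : ∀ a N S → S ∈ sublists (range a N) → AllPairs _<_ S × All (InInterval a N) S
  ∈-sublists-range⁻ a zero    S (here refl) = [] , []
  ∈-sublists-range⁻ a (suc N) S S∈ with ∈-++⁻ (map (a ∷_) (sublists (range (suc a) N))) S∈
  ... | inj₁ S∈′ with ∈-map⁻ (a ∷_) S∈′
  ...   | S′ , S′∈ , refl with ∈-sublists-range⁻ (suc a) N S′ S′∈
  ...     | S′↑ , S′⊆ = (All.map proj₁ S′⊆ ∷ S′↑) , (InInterval-head a N ∷ All.map InInterval-suc S′⊆)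
  ∈-sublists-range⁻ a (suc N) S S∈ | inj₂ S∈′ with ∈-sublists-range⁻ (suc a) N S S∈′
  ... | S↑ , S⊆ = S↑ , All.map InInterval-suc S⊆

  ∈-sublists-range⁺ : ∀ a N S → AllPairs _<_ S → All (InInterval a N) S → S ∈ sublists (range a N)
  ∈-sublists-range⁺ a N       []      _             _                       = []∈sublists (range a N)
  ∈-sublists-range⁺ a zero    (x ∷ S) _             ((a≤x , x<) ∷ _)         =
    ⊥-elim (ℕ.<⇒≱ x< (subst (_≤ x) (sym (ℕ.+-identityʳ a)) a≤x))
  ∈-sublists-range⁺ a (suc N) (x ∷ S) (x<S ∷ S↑) ((a≤x , x<) ∷ S⊆) with x ≟ a
  ... | yes refl = ∈-++⁺ˡ (∈-map⁺ (a ∷_) (∈-sublists-range⁺ (suc a) N S S↑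
                     (All.zipWith (λ (a<y , y∈) → InInterval-pred a<y y∈) (x<S , S⊆))))
  ... | no  x≢a  = ∈-++⁺ʳ (map (a ∷_) (sublists (range (suc a) N))) (∈-sublists-range⁺ (suc a) N (x ∷ S) (x<S ∷ S↑)
                     (InInterval-pred a<x (a≤x , x<) ∷ All.zipWith (λ (x<y , y∈) → InInterval-pred (ℕ.<-trans a<x x<y) y∈) (x<S , S⊆)))
    where
    a<x : a < x
    a<x = ℕ.≤∧≢⇒< a≤x (λ a≡x → x≢a (sym a≡x))

  maxL-lub : ∀ xs K → All (_≤ K) xs → maxL xs ≤ K
  maxL-lub []       K []             = z≤n
  maxL-lub (x ∷ xs) K (x≤K ∷ xs≤K) = ℕ.⊔-lub x≤K (maxL-lub xs K xs≤K)

  ≤-maxL : ∀ {x} xs → x ∈ xs → x ≤ maxL xs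
  ≤-maxL (y ∷ xs) (here refl) = ℕ.m≤m⊔n y (maxL xs)
  ≤-maxL (y ∷ xs) (there x∈)  = ℕ.≤-trans (≤-maxL xs x∈) (ℕ.m≤n⊔m y (maxL xs))

  maxL-attained : ∀ xs → maxL xs ≡ 0 ⊎ maxL xs ∈ xs
  maxL-attained []       = inj₁ refl
  maxL-attained (x ∷ xs) with ℕ.⊔-sel x (maxL xs)
  ... | inj₁ x⊔≡x = inj₂ (here x⊔≡x)
  ... | inj₂ x⊔≡m with maxL-attained xs
  ...   | inj₁ m≡0 = inj₁ (trans x⊔≡m m≡0)
  ...   | inj₂ m∈  = inj₂ (there (subst (_∈ xs) (sym x⊔≡m) m∈))

module Packing (j : ℕ) where
  open import Relation.Binary.PropositionalEquality using (refl; sym; trans)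
  open import Data.Nat using (_+_)
  open Positions

  admissible : (ℕ → Bool) → List ℕ → Bool
  admissible match []      = true
  admissible match (i ∷ s) =
    if match i then (if allB (disjointWin j i) s then admissible match s else false) else false

  packing : (ℕ → Bool) → ℕ → ℕ
  packing match N = maxL (map length (filterᵇ (admissible match) (sublists (range 0 N))))

  Packs : (ℕ → Bool) → ℕ → List ℕ → Set
  Packs match N S = AllPairs _<_ S × All (InInterval 0 N) S × admissible match S ≡ true

  private
    true≢false : true ≢ false
    true≢false ()

    allB⇒All : ∀ P s → allB P s ≡ true → All (λ y → P y ≡ true) s
    allB⇒All P []      _  = []
    allB⇒All P (a ∷ s) eq with P a in Pa | eq
    ... | true  | eq′ = Pa ∷ allB⇒All P s eq′
    ... | false | ()

    All⇒allB : ∀ P s → All (λ y → P y ≡ true) s → allB P s ≡ true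
    All⇒allB P []      []        = refl
    All⇒allB P (a ∷ s) (Pa ∷ Ps) rewrite Pa = All⇒allB P s Ps

  admissible-∷⁻ : ∀ match x s → admissible match (x ∷ s) ≡ true →
    match x ≡ true × All (λ y → disjointWin j x y ≡ true) s × admissible match s ≡ true
  admissible-∷⁻ match x s adm with match x | allB (disjointWin j x) s in all≡ | adm
  ... | true  | true  | adm′ = refl , allB⇒All (disjointWin j x) s all≡ , adm′
  ... | true  | false | ()
  ... | false | _     | ()

  admissible-∷⁺ : ∀ match x s → match x ≡ true → All (λ y → disjointWin j x y ≡ true) s → admissible match s ≡ true →
    admissible match (x ∷ s) ≡ true
  admissible-∷⁺ match x s mx disj adm rewrite mx | All⇒allB (disjointWin j x) s disj = adm

  admissible-cong : ∀ match match′ s → (∀ i → match i ≡ match′ i) → admissible match s ≡ admissible match′ s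
  admissible-cong match match′ []      _ = refl
  admissible-cong match match′ (i ∷ s) m≡ rewrite m≡ i | admissible-cong match match′ s m≡ = refl

  disjointWin-+ : ∀ c x y → disjointWin j (c + x) (c + y) ≡ disjointWin j x y
  disjointWin-+ c x y = cong₂ (λ a b → if a then true else b) (shift x y) (shift y x)
    where
    shift : ∀ x y → does ((c + x + j) ≤? (c + y)) ≡ does ((x + j) ≤? y)
    shift x y = does-⇔ (mk⇔ (λ le → ℕ.+-cancelˡ-≤ c _ _ (subst (_≤ c + y) (ℕ.+-assoc c x j) le))
                           (λ le → subst (_≤ c + y) (sym (ℕ.+-assoc c x j)) (ℕ.+-monoʳ-≤ c le))) ((c + x + j) ≤? (c + y)) ((x + j) ≤? y)

  private
    allB-disjointWin-+ : ∀ c x s → allB (disjointWin j (c + x)) (map (c +_) s) ≡ allB (disjointWin j x) s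
    allB-disjointWin-+ c x []      = refl
    allB-disjointWin-+ c x (y ∷ s) rewrite disjointWin-+ c x y | allB-disjointWin-+ c x s = refl

  admissible-map-+ : ∀ match c s → admissible match (map (c +_) s) ≡ admissible (λ i → match (c + i)) s
  admissible-map-+ match c []      = refl
  admissible-map-+ match c (x ∷ s) rewrite allB-disjointWin-+ c x s | admissible-map-+ match c s = refl

  private
    if-does-true : ∀ {P : Set} (P? : Dec P) (b : Bool) → P → (if does P? then true else b) ≡ true
    if-does-true (yes _) b _ = refl
    if-does-true (no ¬p) b p = ⊥-elim (¬p p)

    if-does-true⁻ : ∀ {P Q : Set} (P? : Dec P) (Q? : Dec Q) → (if does P? then true else does Q?) ≡ true → P ⊎ Q
    if-does-true⁻ (yes p) _       _  = inj₁ p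
    if-does-true⁻ (no _)  (yes q) _  = inj₂ q
    if-does-true⁻ (no _)  (no _)  ()

  disjointWin-true : ∀ x y → x + j ≤ y → disjointWin j x y ≡ true
  disjointWin-true x y = if-does-true ((x + j) ≤? y) _

  disjointWin-true⁻ : ∀ x y → disjointWin j x y ≡ true → x < y → x + j ≤ y
  disjointWin-true⁻ x y disj x<y with if-does-true⁻ ((x + j) ≤? y) ((y + j) ≤? x) disj
  ... | inj₁ x+j≤y = x+j≤y
  ... | inj₂ y+j≤x = ⊥-elim (ℕ.<⇒≱ x<y (ℕ.≤-trans (ℕ.m≤m+n y j) y+j≤x))

  packing-≤ : ∀ match N S → Packs match N S → length S ≤ packing match N
  packing-≤ match N S (S↑ , S⊆ , adm) =
    ≤-maxL _ (∈-map⁺ length (∈-filter⁺ (λ S → T? (admissible match S)) (∈-sublists-range⁺ 0 N S S↑ S⊆)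
                                      (Equivalence.from Bool.T-≡ adm)))

  packing-attained : ∀ match N → ∃ λ S → Packs match N S × length S ≡ packing match N
  packing-attained match N with maxL-attained (map length (filterᵇ (admissible match) (sublists (range 0 N))))
  ... | inj₁ max≡0 = [] , ([] , [] , refl) , sym max≡0
  ... | inj₂ max∈ with ∈-map⁻ length max∈
  ...   | S , S∈ , max≡ with ∈-filter⁻ (λ S → T? (admissible match S)) {xs = sublists (range 0 N)} S∈
  ...     | S∈′ , adm with ∈-sublists-range⁻ 0 N S S∈′
  ...       | S↑ , S⊆ = S , (S↑ , S⊆ , Equivalence.to Bool.T-≡ adm) , sym max≡

  packing-unique : ∀ match N K → (∃ λ S → Packs match N S × length S ≡ K) →
    (∀ S → Packs match N S → length S ≤ K) → packing match N ≡ K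
  packing-unique match N K (S , packs , len≡K) maximal with packing-attained match N
  ... | S* , packs* , len≡ =
    ℕ.≤-antisym (subst (_≤ K) len≡ (maximal S* packs*)) (subst (_≤ packing match N) len≡K (packing-≤ match N S packs))

  packing-cong : ∀ match match′ N → (∀ i → match i ≡ match′ i) → packing match N ≡ packing match′ N
  packing-cong match match′ N m≡ with packing-attained match N
  ... | S , (S↑ , S⊆ , adm) , len≡ = sym (packing-unique match′ N (packing match N)
          (S , (S↑ , S⊆ , trans (sym (admissible-cong match match′ S m≡)) adm) , len≡)
          (λ S′ (S′↑ , S′⊆ , adm′) → packing-≤ match N S′ (S′↑ , S′⊆ , trans (admissible-cong match match′ S′ m≡) adm′)))

  packing-none : ∀ match N → (∀ i → i < N → match i ≡ false) → packing match N ≡ 0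
  packing-none match N none = packing-unique match N 0 ([] , ([] , [] , refl) , refl) empty
    where
    empty : ∀ S → Packs match N S → length S ≤ 0
    empty []      _                                   = z≤n
    empty (x ∷ S) (_ , (_ , x<N) ∷ _ , adm) with admissible-∷⁻ match x S adm
    ... | mx , _ = ⊥-elim (true≢false (trans (sym mx) (none x x<N)))

  private
    ≥⇒map-+ : ∀ c S → All (c ≤_) S → Σ[ S′ ∈ List ℕ ] S ≡ map (c +_) S′
    ≥⇒map-+ c []      []          = [] , refl
    ≥⇒map-+ c (s ∷ S) (c≤s ∷ c≤S) with ≥⇒map-+ c S c≤S
    ... | S′ , refl = (s ∸ c) ∷ S′ , cong (_∷ map (c +_) S′) (sym (ℕ.m+[n∸m]≡n c≤s))

    <∸⇒+< : ∀ c s N → s < N ∸ c → c + s < N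
    <∸⇒+< c s N s<N∸c with c ℕ.≤? N
    ... | yes c≤N = subst (_≤ N) (cong suc (ℕ.+-comm s c)) (ℕ.m≤o∸n⇒m+n≤o (suc s) c≤N s<N∸c)
    ... | no  c≰N = ⊥-elim (ℕ.n≮0 (subst (s <_) (ℕ.m≤n⇒m∸n≡0 (ℕ.<⇒≤ (ℕ.≰⇒> c≰N))) s<N∸c))

    +<⇒<∸ : ∀ c s N → c + s < N → s < N ∸ c
    +<⇒<∸ c s N c+s<N = ℕ.m+n≤o⇒m≤o∸n (suc s) (subst (_≤ N) (cong suc (ℕ.+-comm c s)) c+s<N)

  -- Greedy choice: a maximal packing may start with the first match a, and its other windows start
  -- at or after a + j.
  packing-first : 1 ≤ j → ∀ match N a → a < N → match a ≡ true → (∀ i → i < a → match i ≡ false) →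
    packing match N ≡ suc (packing (λ i → match (a + j + i)) (N ∸ (a + j)))
  packing-first 1≤j match N a a<N ma before = packing-unique match N (suc (packing match′ N′)) witness maximal
    where
    c = a + j
    match′ = λ i → match (c + i)
    N′ = N ∸ c
    witness : ∃ λ S → Packs match N S × length S ≡ suc (packing match′ N′)
    witness with packing-attained match′ N′
    ... | S* , (S*↑ , S*⊆ , adm*) , len* =
      a ∷ map (c +_) S* ,
      ( (Allₚ.map⁺ (All.tabulate (λ {s} _ → ℕ.<-≤-trans (ℕ.m<m+n a 1≤j) (ℕ.m≤m+n c s)))
          ∷ AllPairsₚ.map⁺ (AllPairs.map (ℕ.+-monoʳ-< c) S*↑))
      , ((z≤n , a<N) ∷ Allₚ.map⁺ (All.map (λ {s} (_ , s<) → z≤n , <∸⇒+< c s N s<) S*⊆))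
      , admissible-∷⁺ match a (map (c +_) S*) ma
          (Allₚ.map⁺ (All.tabulate (λ {s} _ → disjointWin-true a (c + s) (ℕ.m≤m+n c s))))
          (trans (admissible-map-+ match c S*) adm*) )
      , cong suc (trans (List.length-map (c +_) S*) len*)
    first≤ : ∀ s → match s ≡ true → a ≤ s
    first≤ s ms with a ℕ.≤? s
    ... | yes a≤s = a≤s
    ... | no  a≰s = ⊥-elim (true≢false (trans (sym ms) (before s (ℕ.≰⇒> a≰s))))
    maximal : ∀ S → Packs match N S → length S ≤ suc (packing match′ N′)
    maximal []       _ = z≤n
    maximal (s₀ ∷ S) ((s₀<S ∷ S↑) , (_ ∷ S⊆) , adm) with admissible-∷⁻ match s₀ S adm
    ... | ms₀ , disj , adm′ with ≥⇒map-+ c S (All.zipWith (λ (s₀<s , d) →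
                                   ℕ.≤-trans (ℕ.+-monoˡ-≤ j (first≤ s₀ ms₀)) (disjointWin-true⁻ s₀ _ d s₀<s)) (s₀<S , disj))
    ...   | S′ , refl = s≤s (subst (_≤ packing match′ N′) (sym (List.length-map (c +_) S′))
            (packing-≤ match′ N′ S′
              ( AllPairs.map (ℕ.+-cancelˡ-< c _ _) (AllPairsₚ.map⁻ S↑)
              , All.map (λ {s} (_ , c+s<) → z≤n , +<⇒<∸ c s N c+s<) (Allₚ.map⁻ S⊆)
              , trans (sym (admissible-map-+ match c S′)) adm′ )))

module Reduction where
  open import Relation.Binary.PropositionalEquality using (sym; trans)
  open Counting

  redP-map : ∀ (g : ℕ → ℕ) L → (∀ a b → a ∈ L → b ∈ L → lt (g b) (g a) ≡ lt b a) → redP (map g L) ≡ redP L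
  redP-map g L g-monotone = begin
    map (λ a → suc (countP (λ b → lt b a) (map g L))) (map g L)   ≡⟨ List.map-∘ L ⟨
    map (λ a → suc (countP (λ b → lt b (g a)) (map g L))) L       ≡⟨ List.map-cong-local (All.tabulate (λ {a} a∈ →
                                                                      cong suc (trans (countP-map (λ b → lt b (g a)) g L)
                                                                        (countP-cong _ _ L (λ b b∈ → g-monotone a b a∈ b∈))))) ⟩
    map (λ a → suc (countP (λ b → lt b a) L)) L                  ∎
    where open ≡-Reasoning

  rank : List ℕ → ℕ → ℕ
  rank L a = suc (countP (λ b → lt b a) L)

  rank-monotone : ∀ L a b → a ∈ L → b ∈ L → lt (rank L b) (rank L a) ≡ lt b a
  rank-monotone L a b a∈ b∈ with b <? a
  ... | yes b<a = trans (lt-true (s≤s (countP-mono-< (λ c → lt c b) (λ c → lt c a) L b b∈ (lt-false {b} ℕ.≤-refl) (lt-true b<a)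
                                         (λ c c<b → lt-true (ℕ.<-trans (lt-true⁻ c<b) b<a)))))
                        (sym (lt-true b<a))
  ... | no  b≮a = trans (lt-false (s≤s (countP-mono (λ c → lt c a) (λ c → lt c b) L
                                         (λ c c<a → lt-true (ℕ.<-≤-trans (lt-true⁻ c<a) (ℕ.≮⇒≥ b≮a))))))
                        (sym (lt-false (ℕ.≮⇒≥ b≮a)))

  redP-window : ∀ i m L → redP (take i (drop m (redP L))) ≡ redP (take i (drop m L))
  redP-window i m L = begin
    redP (take i (drop m (map (rank L) L)))        ≡⟨ cong (redP ∘ take i) (List.drop-map m L) ⟩
    redP (take i (map (rank L) (drop m L)))        ≡⟨ cong redP (List.take-map i (drop m L)) ⟩
    redP (map (rank L) (take i (drop m L)))        ≡⟨ redP-map (rank L) (take i (drop m L)) (λ a b a∈ b∈ →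
                                                       rank-monotone L a b (∈-window a∈) (∈-window b∈)) ⟩
    redP (take i (drop m L))                       ∎
    where
    open ≡-Reasoning
    ∈-take : ∀ {x} i (L : List ℕ) → x ∈ take i L → x ∈ L
    ∈-take (suc i) (a ∷ L) (here x≡a) = here x≡a
    ∈-take (suc i) (a ∷ L) (there x∈) = there (∈-take i L x∈)
    ∈-drop : ∀ {x} i (L : List ℕ) → x ∈ drop i L → x ∈ L
    ∈-drop zero    L       x∈ = x∈
    ∈-drop (suc i) (a ∷ L) x∈ = there (∈-drop i L x∈)
    ∈-window : ∀ {x} → x ∈ take i (drop m L) → x ∈ L
    ∈-window x∈ = ∈-drop m L (∈-take i _ x∈)

module Matches (Υ : Pattern) (j : ℕ) where
  open import Relation.Binary.PropositionalEquality using (refl; sym; trans)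
  open import Data.Nat using (_+_)
  open Counting
  open Reduction
  open Positions
  open Packing j

  matchAt-window : ∀ σ w σ′ w′ m m′ → redP (take j (drop m σ)) ≡ redP (take j (drop m′ σ′)) →
    take j (drop m w) ≡ take j (drop m′ w′) → matchAt Υ j σ w m ≡ matchAt Υ j σ′ w′ m′
  matchAt-window σ w σ′ w′ m m′ τ≡ u≡ = cong₂ (λ τ u → does ((τ , redW u) ∈? Υ)) τ≡ u≡

  matchAt-redP : ∀ L u m → matchAt Υ j (redP L) u m ≡ matchAt Υ j L u m
  matchAt-redP L u m = matchAt-window (redP L) u L u m m (redP-window j m L) refl

  matchAt-take : ∀ i σ w m → m + j ≤ i → matchAt Υ j (take i σ) (take i w) m ≡ matchAt Υ j σ w m
  matchAt-take i σ w m m+j≤i = matchAt-window _ _ _ _ m m (cong redP (window-take i m σ m+j≤i)) (window-take i m w m+j≤i)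
    where
    window-take : ∀ i m (L : List ℕ) → m + j ≤ i → take j (drop m (take i L)) ≡ take j (drop m L)
    window-take i       zero    L       j≤i          = trans (List.take-take j i L) (cong (λ n → take n L) (ℕ.m≤n⇒m⊓n≡m j≤i))
    window-take (suc i) (suc m) []      _            = refl
    window-take (suc i) (suc m) (a ∷ L) (s≤s m+j≤i) = window-take i m L m+j≤i

  matchAt-drop : ∀ i σ w m → matchAt Υ j (drop i σ) (drop i w) m ≡ matchAt Υ j σ w (i + m)
  matchAt-drop i σ w m = matchAt-window _ _ _ _ m (i + m) (cong (redP ∘ take j) (List.drop-drop i m σ))
                                                          (cong (take j) (List.drop-drop i m w))

  matchFree : List ℕ → List ℕ → Bool
  matchFree τ u = does (mch Υ j τ u ≟ 0)

  NoMatchWithin : List ℕ → List ℕ → ℕ → Set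
  NoMatchWithin τ u E = ∀ m → m + j ≤ E → matchAt Υ j τ u m ≡ false

  private
    does-true⇒ : ∀ {A : Set} (A? : Dec A) → does A? ≡ true → A
    does-true⇒ (yes a) _  = a
    does-true⇒ (no _)  ()

  matchFree⇒ : ∀ τ u → matchFree τ u ≡ true → NoMatchWithin τ u (length τ)
  matchFree⇒ τ u free m m+j≤ =
    All.lookup (countP-none⁻ (matchAt Υ j τ u) _ (does-true⇒ (mch Υ j τ u ≟ 0) free)) (∈-positions⁺ j (length τ) m+j≤)

  ⇒matchFree : ∀ τ u → NoMatchWithin τ u (length τ) → matchFree τ u ≡ true
  ⇒matchFree τ u none = dec-true (mch Υ j τ u ≟ 0)
    (countP-none (matchAt Υ j τ u) _ (All.tabulate (λ m∈ → none _ (∈-positions⁻ j (length τ) m∈))))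

  matchFree-redP : ∀ τ u → matchFree (redP τ) u ≡ matchFree τ u
  matchFree-redP τ u = cong (λ n → does (n ≟ 0)) (begin
    countP (matchAt Υ j (redP τ) u) (positions j (length (redP τ)))  ≡⟨ cong (countP (matchAt Υ j (redP τ) u) ∘ positions j) (List.length-map _ τ) ⟩
    countP (matchAt Υ j (redP τ) u) (positions j (length τ))         ≡⟨ countP-cong _ _ (positions j (length τ)) (λ m _ → matchAt-redP τ u m) ⟩
    countP (matchAt Υ j τ u) (positions j (length τ))                ∎)
    where open ≡-Reasoning

  nlap≡packing : ∀ σ w → nlap Υ j σ w ≡ packing (matchAt Υ j σ w) (suc (length σ) ∸ j)
  nlap≡packing σ w = cong (maxL ∘ map length) (begin
    filterᵇ (nonOverlapping Υ j σ w) (sublists (positions j (length σ)))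
      ≡⟨ List.filter-≐ (T? ∘ nonOverlapping Υ j σ w) (T? ∘ admissible (matchAt Υ j σ w))
                       ((λ {S} → subst T (same S)) , (λ {S} → subst T (sym (same S)))) (sublists (positions j (length σ))) ⟩
    filterᵇ (admissible (matchAt Υ j σ w)) (sublists (positions j (length σ)))
      ≡⟨ cong (filterᵇ (admissible (matchAt Υ j σ w)) ∘ sublists) (positions≡range j (length σ)) ⟩
    filterᵇ (admissible (matchAt Υ j σ w)) (sublists (range 0 (suc (length σ) ∸ j))) ∎)
    where
    open ≡-Reasoning
    same : ∀ S → nonOverlapping Υ j σ w S ≡ admissible (matchAt Υ j σ w) S
    same []      = refl
    same (i ∷ S) rewrite same S = refl

module FirstMatch (Υ : Pattern) (j : ℕ) (1≤j : 1 ≤ j) where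
  open import Relation.Binary.PropositionalEquality using (refl; sym; trans)
  open import Data.Nat using (_+_)
  open Packing j
  open Matches Υ j

  firstMatch : ∀ (match : ℕ → Bool) N → (∀ i → i < N → match i ≡ false) ⊎
    ∃ λ a → a < N × match a ≡ true × (∀ i → i < a → match i ≡ false)
  firstMatch match zero = inj₁ (λ i ())
  firstMatch match (suc N) with match 0 in m0
  ... | true  = inj₂ (0 , s≤s z≤n , m0 , λ i ())
  ... | false with firstMatch (λ i → match (suc i)) N
  ...   | inj₁ none                   = inj₁ (λ { zero _ → m0 ; (suc i) (s≤s i<N) → none i i<N })
  ...   | inj₂ (a , a<N , ma , before) = inj₂ (suc a , s≤s a<N , ma , λ { zero _ → m0 ; (suc i) (s≤s i<a) → before i i<a })

  prefix : List ℕ → List ℕ → ℕ → List ℕ × List ℕ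
  prefix σ w e = redP (take e σ) , take e w

  firstMatchAtEnd : List ℕ × List ℕ → Bool
  firstMatchAtEnd (τ , u) = matchFree (take (pred (length τ)) τ) (take (pred (length τ)) u) ∧ not (matchFree τ u)

  NoMatchWithin-take : ∀ σ w e E → E ≤ e → NoMatchWithin (take e σ) (take e w) E ⇔ NoMatchWithin σ w E
  NoMatchWithin-take σ w e E E≤e = mk⇔
    (λ none m m+j≤E → trans (sym (matchAt-take e σ w m (ℕ.≤-trans m+j≤E E≤e))) (none m m+j≤E))
    (λ none m m+j≤E → trans (matchAt-take e σ w m (ℕ.≤-trans m+j≤E E≤e)) (none m m+j≤E))

  NoMatchWithin-redP : ∀ τ u E → NoMatchWithin (redP τ) u E ⇔ NoMatchWithin τ u E
  NoMatchWithin-redP τ u E = mk⇔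
    (λ none m m+j≤E → trans (sym (matchAt-redP τ u m)) (none m m+j≤E))
    (λ none m m+j≤E → trans (matchAt-redP τ u m) (none m m+j≤E))

  matchFree⇔ : ∀ τ u E → length τ ≡ E → matchFree τ u ≡ true ⇔ NoMatchWithin τ u E
  matchFree⇔ τ u E refl = mk⇔ (matchFree⇒ τ u) (⇒matchFree τ u)

  private
    length-redP-take : ∀ σ e → e ≤ length σ → length (redP (take e σ)) ≡ e
    length-redP-take σ e e≤ = trans (List.length-map _ (take e σ)) (trans (List.length-take e σ) (ℕ.m≤n⇒m⊓n≡m e≤))

    ⇔-bool : ∀ {b} {P : Set} → b ≡ true ⇔ P → (P → b ≡ true) × (¬ P → b ≡ false)
    ⇔-bool b⇔P = Equivalence.from b⇔P , λ ¬P → Bool.¬-not (λ b≡ → ¬P (Equivalence.to b⇔P b≡))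

  matchFree-prefix : ∀ σ w e → e ≤ length σ →
    matchFree (redP (take e σ)) (take e w) ≡ true ⇔ NoMatchWithin σ w e
  matchFree-prefix σ w e e≤ =
    NoMatchWithin-take σ w e e ℕ.≤-refl ⇔-∘
    (NoMatchWithin-redP (take e σ) (take e w) e ⇔-∘
     matchFree⇔ (redP (take e σ)) (take e w) e (length-redP-take σ e e≤))

  matchFree-shortPrefix : ∀ σ w e → e ≤ length σ → let E = pred (length (redP (take e σ))) in
    matchFree (take E (redP (take e σ))) (take E (take e w)) ≡ true ⇔ NoMatchWithin σ w (pred e)
  matchFree-shortPrefix σ w e e≤ =
    NoMatchWithin-take σ w e (pred e) ℕ.pred[n]≤n ⇔-∘
    (NoMatchWithin-redP (take e σ) (take e w) (pred e) ⇔-∘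
     (NoMatchWithin-take (redP (take e σ)) (take e w) E (pred e) (ℕ.≤-reflexive (sym E≡)) ⇔-∘
      matchFree⇔ (take E (redP (take e σ))) (take E (take e w)) (pred e)
                 (trans (List.length-take E _) (trans (ℕ.m≤n⇒m⊓n≡m ℕ.pred[n]≤n) E≡))))
    where
    E = pred (length (redP (take e σ)))
    E≡ : E ≡ pred e
    E≡ = cong pred (length-redP-take σ e e≤)

  firstMatchAtEnd-prefix-true : ∀ σ w e → e ≤ length σ → NoMatchWithin σ w (pred e) → ¬ NoMatchWithin σ w e →
    firstMatchAtEnd (prefix σ w e) ≡ true
  firstMatchAtEnd-prefix-true σ w e e≤ before at = cong₂ (λ a b → a ∧ not b)
    (proj₁ (⇔-bool (matchFree-shortPrefix σ w e e≤)) before) (proj₂ (⇔-bool (matchFree-prefix σ w e e≤)) at)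

  firstMatchAtEnd-prefix-noMatch : ∀ σ w e → e ≤ length σ → NoMatchWithin σ w e → firstMatchAtEnd (prefix σ w e) ≡ false
  firstMatchAtEnd-prefix-noMatch σ w e e≤ none =
    trans (cong (λ b → shortFree ∧ not b) (proj₁ (⇔-bool (matchFree-prefix σ w e e≤)) none)) (Bool.∧-zeroʳ shortFree)
    where
    E = pred (length (redP (take e σ)))
    shortFree = matchFree (take E (redP (take e σ))) (take E (take e w))

  firstMatchAtEnd-prefix-earlier : ∀ σ w e → e ≤ length σ → ¬ NoMatchWithin σ w (pred e) → firstMatchAtEnd (prefix σ w e) ≡ false
  firstMatchAtEnd-prefix-earlier σ w e e≤ earlier =
    cong (λ a → a ∧ not (matchFree (redP (take e σ)) (take e w))) (proj₂ (⇔-bool (matchFree-shortPrefix σ w e e≤)) earlier)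

  private
    <∸⇒+≤ : ∀ i E → i < suc E ∸ j → i + j ≤ E
    <∸⇒+≤ i E i< with j ℕ.≤? suc E
    ... | yes j≤ = ℕ.≤-pred (ℕ.m≤o∸n⇒m+n≤o (suc i) j≤ i<)
    ... | no  j≰ = ⊥-elim (ℕ.n≮0 (subst (i <_) (ℕ.m≤n⇒m∸n≡0 (ℕ.<⇒≤ (ℕ.≰⇒> j≰))) i<))

    +≤⇒<∸ : ∀ i E → i + j ≤ E → i < suc E ∸ j
    +≤⇒<∸ i E i+j≤E = ℕ.m+n≤o⇒m≤o∸n (suc i) (s≤s i+j≤E)

  nlap-matchFree : ∀ σ w → matchFree σ w ≡ true → nlap Υ j σ w ≡ 0
  nlap-matchFree σ w free = trans (nlap≡packing σ w)
    (packing-none (matchAt Υ j σ w) (suc (length σ) ∸ j) (λ i i< → matchFree⇒ σ w free i (<∸⇒+≤ i (length σ) i<)))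

  firstMatchAtEnd-matchFree : ∀ σ w → matchFree σ w ≡ true → ∀ e → e ≤ length σ → firstMatchAtEnd (prefix σ w e) ≡ false
  firstMatchAtEnd-matchFree σ w free e e≤ =
    firstMatchAtEnd-prefix-noMatch σ w e e≤ (λ m m+j≤e → matchFree⇒ σ w free m (ℕ.≤-trans m+j≤e e≤))

  nlap-firstMatch : ∀ σ w a → a < suc (length σ) ∸ j → matchAt Υ j σ w a ≡ true →
    (∀ i → i < a → matchAt Υ j σ w i ≡ false) →
    nlap Υ j σ w ≡ suc (nlap Υ j (redP (drop (a + j) σ)) (drop (a + j) w))
  nlap-firstMatch σ w a a< ma before =
    trans (nlap≡packing σ w) (trans (packing-first 1≤j (matchAt Υ j σ w) _ a a< ma before)
      (cong suc (sym (trans (nlap≡packing (redP (drop e₀ σ)) (drop e₀ w))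
        (trans (packing-cong (matchAt Υ j (redP (drop e₀ σ)) (drop e₀ w)) (λ i → matchAt Υ j σ w (e₀ + i))
                             (suc (length (redP (drop e₀ σ))) ∸ j)
                             (λ i → trans (matchAt-redP (drop e₀ σ) (drop e₀ w) i) (matchAt-drop e₀ σ w i)))
               (cong (packing (λ i → matchAt Υ j σ w (e₀ + i))) suffix-positions))))))
    where
    e₀ = a + j
    e₀≤ : e₀ ≤ length σ
    e₀≤ = <∸⇒+≤ a (length σ) a<
    suffix-positions : suc (length (redP (drop e₀ σ))) ∸ j ≡ (suc (length σ) ∸ j) ∸ e₀
    suffix-positions = begin
      suc (length (redP (drop e₀ σ))) ∸ j  ≡⟨ cong (λ l → suc l ∸ j) (trans (List.length-map _ (drop e₀ σ)) (List.length-drop e₀ σ)) ⟩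
      suc (length σ ∸ e₀) ∸ j              ≡⟨ cong (_∸ j) (ℕ.+-∸-assoc 1 e₀≤) ⟨
      (suc (length σ) ∸ e₀) ∸ j            ≡⟨ ℕ.∸-+-assoc (suc (length σ)) e₀ j ⟩
      suc (length σ) ∸ (e₀ + j)            ≡⟨ cong (suc (length σ) ∸_) (ℕ.+-comm e₀ j) ⟩
      suc (length σ) ∸ (j + e₀)            ≡⟨ ℕ.∸-+-assoc (suc (length σ)) j e₀ ⟨
      (suc (length σ) ∸ j) ∸ e₀            ∎
      where open ≡-Reasoning

  firstMatch-decomposition : ∀ σ w → matchFree σ w ≡ false → ∃ λ e₀ → e₀ ≤ length σ
    × firstMatchAtEnd (prefix σ w e₀) ≡ true
    × (∀ e → e ≤ length σ → e ≢ e₀ → firstMatchAtEnd (prefix σ w e) ≡ false)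
    × nlap Υ j σ w ≡ suc (nlap Υ j (redP (drop e₀ σ)) (drop e₀ w))
  firstMatch-decomposition σ w matched with firstMatch (matchAt Υ j σ w) (suc (length σ) ∸ j)
  ... | inj₁ none = ⊥-elim (Bool.not-¬ matched (⇒matchFree σ w (λ m m+j≤ → none m (+≤⇒<∸ m (length σ) m+j≤))))
  ... | inj₂ (a , a< , ma , before) = e₀ , e₀≤ , atEnd , elsewhere , nlap-firstMatch σ w a a< ma before
    where
    e₀ = a + j
    e₀≤ : e₀ ≤ length σ
    e₀≤ = <∸⇒+≤ a (length σ) a<
    none-below : ∀ E → E < e₀ → NoMatchWithin σ w E
    none-below E E<e₀ m m+j≤E = before m (ℕ.+-cancelʳ-< j m a (ℕ.≤-<-trans m+j≤E E<e₀))
    some-above : ∀ E → e₀ ≤ E → ¬ NoMatchWithin σ w E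
    some-above E e₀≤E none = Bool.not-¬ ma (none a e₀≤E)
    atEnd : firstMatchAtEnd (prefix σ w e₀) ≡ true
    atEnd = firstMatchAtEnd-prefix-true σ w e₀ e₀≤ (none-below (pred e₀) (pred< e₀ (ℕ.<-≤-trans 1≤j (ℕ.m≤n+m j a))))
                                                   (some-above e₀ ℕ.≤-refl)
      where
      pred< : ∀ n → 0 < n → pred n < n
      pred< (suc n) _ = ℕ.≤-refl
    elsewhere : ∀ e → e ≤ length σ → e ≢ e₀ → firstMatchAtEnd (prefix σ w e) ≡ false
    elsewhere e e≤ e≢e₀ with ℕ.<-cmp e e₀
    ... | tri< e<e₀ _ _ = firstMatchAtEnd-prefix-noMatch σ w e e≤ (none-below e e<e₀)
    ... | tri≈ _ e≡e₀ _ = ⊥-elim (e≢e₀ e≡e₀)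
    ... | tri> _ _ e₀<e = firstMatchAtEnd-prefix-earlier σ w e e≤ (some-above (pred e) (ℕ.<⇒≤pred e₀<e))

  matchFree-take : ∀ σ w E → E ≤ length σ → matchFree σ w ≡ true → matchFree (take E σ) (take E w) ≡ true
  matchFree-take σ w E E≤ free =
    Equivalence.from (matchFree⇔ (take E σ) (take E w) E (trans (List.length-take E σ) (ℕ.m≤n⇒m⊓n≡m E≤)))
      (Equivalence.from (NoMatchWithin-take σ w E E ℕ.≤-refl)
        (λ m m+j≤E → matchFree⇒ σ w free m (ℕ.≤-trans m+j≤E E≤)))

module FiniteSums {c ℓ} (R : CommutativeRing c ℓ) where
  open CommutativeRing R
  open Series R
  open import Relation.Binary.Reasoning.Setoid setoid
  open import Algebra.Properties.Ring ring using (-‿+-comm; -0#≈0#)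
  open import Algebra.Properties.CommutativeSemigroup +-commutativeSemigroup using () renaming (interchange to +-interchange)

  ∑ : ∀ {a} {A : Set a} → (A → Carrier) → List A → Carrier
  ∑ f xs = sumR (map f xs)

  ∑< : (ℕ → Carrier) → ℕ → Carrier
  ∑< f n = sumR (applyUpTo f n)

  𝟙 : Bool → Carrier
  𝟙 true  = 1#
  𝟙 false = 0#

  ∑-map : ∀ {a b} {A : Set a} {B : Set b} (f : B → Carrier) (g : A → B) (xs : List A) → ∑ f (map g xs) ≡ ∑ (λ x → f (g x)) xs
  ∑-map f g xs = ≡.cong sumR (≡.sym (List.map-∘ xs))

  module _ {a} {A : Set a} where

    ∑-cong-∈ : {f g : A → Carrier} (xs : List A) → (∀ x → x ∈ xs → f x ≈ g x) → ∑ f xs ≈ ∑ g xs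
    ∑-cong-∈ []       f≈g = refl
    ∑-cong-∈ (x ∷ xs) f≈g = +-cong (f≈g x (here ≡.refl)) (∑-cong-∈ xs (λ y y∈ → f≈g y (there y∈)))

    ∑-cong : {f g : A → Carrier} (xs : List A) → (∀ x → f x ≈ g x) → ∑ f xs ≈ ∑ g xs
    ∑-cong xs f≈g = ∑-cong-∈ xs (λ x _ → f≈g x)

    ∑-zero : (f : A → Carrier) (xs : List A) → (∀ x → x ∈ xs → f x ≈ 0#) → ∑ f xs ≈ 0#
    ∑-zero f []       f≈0 = refl
    ∑-zero f (x ∷ xs) f≈0 =
      trans (+-cong (f≈0 x (here ≡.refl)) (∑-zero f xs (λ y y∈ → f≈0 y (there y∈)))) (+-identityˡ 0#)

    ∑-++ : (f : A → Carrier) (xs ys : List A) → ∑ f (xs ++ ys) ≈ ∑ f xs + ∑ f ys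
    ∑-++ f []       ys = sym (+-identityˡ _)
    ∑-++ f (x ∷ xs) ys = trans (+-congˡ (∑-++ f xs ys)) (sym (+-assoc _ _ _))

    ∑-+ : (f g : A → Carrier) (xs : List A) → ∑ (λ x → f x + g x) xs ≈ ∑ f xs + ∑ g xs
    ∑-+ f g []       = sym (+-identityˡ 0#)
    ∑-+ f g (x ∷ xs) = trans (+-congˡ (∑-+ f g xs)) (+-interchange _ _ _ _)

    *-distribˡ-∑ : (a : Carrier) (f : A → Carrier) (xs : List A) → a * ∑ f xs ≈ ∑ (λ x → a * f x) xs
    *-distribˡ-∑ a f []       = zeroʳ a
    *-distribˡ-∑ a f (x ∷ xs) = trans (distribˡ a _ _) (+-congˡ (*-distribˡ-∑ a f xs))

    *-distribʳ-∑ : (a : Carrier) (f : A → Carrier) (xs : List A) → ∑ f xs * a ≈ ∑ (λ x → f x * a) xs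
    *-distribʳ-∑ a f xs = trans (*-comm _ a) (trans (*-distribˡ-∑ a f xs) (∑-cong xs (λ x → *-comm a (f x))))

    ∑-filterᵇ : (P : A → Bool) (f : A → Carrier) (xs : List A) → ∑ f (filterᵇ P xs) ≈ ∑ (λ x → 𝟙 (P x) * f x) xs
    ∑-filterᵇ P f []       = refl
    ∑-filterᵇ P f (x ∷ xs) with P x
    ... | true  = +-cong (sym (*-identityˡ _)) (∑-filterᵇ P f xs)
    ... | false = trans (∑-filterᵇ P f xs) (trans (sym (+-identityˡ _)) (+-congʳ (sym (zeroˡ _))))

    ∑-↭ : (f : A → Carrier) {xs ys : List A} → xs ↭ ys → ∑ f xs ≈ ∑ f ys
    ∑-↭ f xs↭ys = ↭ₛ.foldr-commMonoid setoid +-isCommutativeMonoid (↭⇒↭ₛ′ isEquivalence (↭.map⁺ f xs↭ys))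

    ∑-bijection : ∀ {b} {B : Set b} (f : A → Carrier) (xs : List A) (g : B → A) (ys : List B) →
      Unique xs → Unique ys →
      (∀ y → y ∈ ys → g y ∈ xs) → (∀ x → x ∈ xs → ∃ λ y → y ∈ ys × x ≡ g y) →
      (∀ y y′ → y ∈ ys → y′ ∈ ys → g y ≡ g y′ → y ≡ y′) →
      ∑ f xs ≈ ∑ (λ y → f (g y)) ys
    ∑-bijection f xs g ys xs! ys! into onto injective =
      trans (∑-↭ f (∼bag⇒↭ (unique∧set⇒bag xs! (map-unique-on ys ys! injective) (mk⇔ (to _) (from _)))))
            (reflexive (∑-map f g ys))
      where
      to : ∀ x → x ∈ xs → x ∈ map g ys
      to x x∈ with onto x x∈
      ... | y , y∈ , ≡.refl = ∈-map⁺ g y∈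
      from : ∀ x → x ∈ map g ys → x ∈ xs
      from x x∈ with ∈-map⁻ g x∈
      ... | y , y∈ , ≡.refl = into y y∈
      map-unique-on : ∀ zs → Unique zs → (∀ z z′ → z ∈ zs → z′ ∈ zs → g z ≡ g z′ → z ≡ z′) → Unique (map g zs)
      map-unique-on []       []          inj = []
      map-unique-on (z ∷ zs) (z∉ ∷ zs!) inj =
        Allₚ.map⁺ (All.tabulate (λ z′∈ gz≡gz′ → All.lookup z∉ z′∈ (inj _ _ (here ≡.refl) (there z′∈) gz≡gz′)))
        ∷ map-unique-on zs zs! (λ a b a∈ b∈ → inj a b (there a∈) (there b∈))

  ∑-cartesianProductWith : ∀ {a b c′} {A : Set a} {B : Set b} {C : Set c′} (f : C → Carrier) (g : A → B → C) (xs : List A) (ys : List B) →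
    ∑ f (cartesianProductWith g xs ys) ≈ ∑ (λ x → ∑ (λ y → f (g x y)) ys) xs
  ∑-cartesianProductWith f g []       ys = refl
  ∑-cartesianProductWith f g (x ∷ xs) ys = begin
    ∑ f (map (g x) ys ++ cartesianProductWith g xs ys)       ≈⟨ ∑-++ f (map (g x) ys) _ ⟩
    ∑ f (map (g x) ys) + ∑ f (cartesianProductWith g xs ys)   ≈⟨ +-cong (reflexive (∑-map f (g x) ys))
                                                                        (∑-cartesianProductWith f g xs ys) ⟩
    ∑ (λ y → f (g x y)) ys + ∑ (λ x → ∑ (λ y → f (g x y)) ys) xs ∎

  ∑-cartesianProduct : ∀ {a b} {A : Set a} {B : Set b} (f : A × B → Carrier) (xs : List A) (ys : List B) →
    ∑ f (cartesianProduct xs ys) ≈ ∑ (λ x → ∑ (λ y → f (x , y)) ys) xs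
  ∑-cartesianProduct f = ∑-cartesianProductWith f _,_

  ∑-product : ∀ {a b} {A : Set a} {B : Set b} (f : A → Carrier) (g : B → Carrier) (xs : List A) (ys : List B) →
    ∑ (λ x → ∑ (λ y → f x * g y) ys) xs ≈ ∑ f xs * ∑ g ys
  ∑-product f g xs ys =
    trans (∑-cong xs (λ x → sym (*-distribˡ-∑ (f x) g ys))) (sym (*-distribʳ-∑ (∑ g ys) f xs))

  ∑-upTo : (f : ℕ → Carrier) (n : ℕ) → ∑ f (upTo n) ≡ ∑< f n
  ∑-upTo f n = ≡.cong sumR (List.map-upTo f n)

  ∑<-cong : {f g : ℕ → Carrier} (n : ℕ) → (∀ i → i < n → f i ≈ g i) → ∑< f n ≈ ∑< g n
  ∑<-cong zero    f≈g = refl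
  ∑<-cong (suc n) f≈g = +-cong (f≈g 0 (s≤s z≤n)) (∑<-cong n (λ i i<n → f≈g (suc i) (s≤s i<n)))

  ∑<-zero : (f : ℕ → Carrier) (n : ℕ) → (∀ i → i < n → f i ≈ 0#) → ∑< f n ≈ 0#
  ∑<-zero f n f≈0 = trans (∑<-cong n f≈0) (zeros n)
    where
    zeros : ∀ n → ∑< (λ _ → 0#) n ≈ 0#
    zeros zero    = refl
    zeros (suc n) = trans (+-identityˡ _) (zeros n)

  ∑<-single : (f : ℕ → Carrier) (n e : ℕ) → e < n → (∀ i → i < n → i ≢ e → f i ≈ 0#) → ∑< f n ≈ f e
  ∑<-single f (suc n) zero    _         f≈0 =
    trans (+-congˡ (∑<-zero (λ i → f (suc i)) n (λ i i<n → f≈0 (suc i) (s≤s i<n) (λ ())))) (+-identityʳ _)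
  ∑<-single f (suc n) (suc e) (s≤s e<n) f≈0 =
    trans (+-congʳ (f≈0 0 (s≤s z≤n) (λ ()))) (trans (+-identityˡ _)
      (∑<-single (λ i → f (suc i)) n e e<n (λ i i<n i≢e → f≈0 (suc i) (s≤s i<n) (λ eq → i≢e (ℕ.suc-injective eq)))))

  ∑<-split : (f : ℕ → Carrier) (a b : ℕ) → ∑< f (a ℕ.+ b) ≈ ∑< f a + ∑< (λ t → f (a ℕ.+ t)) b
  ∑<-split f zero    b = sym (+-identityˡ _)
  ∑<-split f (suc a) b = trans (+-congˡ (∑<-split (λ i → f (suc i)) a b)) (sym (+-assoc _ _ _))

  ∑<-reverse : (f : ℕ → Carrier) (n : ℕ) → ∑< f n ≈ ∑< (λ i → f (n ∸ suc i)) n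
  ∑<-reverse f zero    = refl
  ∑<-reverse f (suc n) = begin
    ∑< f (suc n)                          ≈⟨ ∑<-snoc f n ⟩
    ∑< f n + f n                          ≈⟨ +-comm _ _ ⟩
    f n + ∑< f n                          ≈⟨ +-congˡ (∑<-reverse f n) ⟩
    f n + ∑< (λ i → f (n ∸ suc i)) n       ∎
    where
    ∑<-snoc : (f : ℕ → Carrier) (n : ℕ) → ∑< f (suc n) ≈ ∑< f n + f n
    ∑<-snoc f zero    = trans (+-identityʳ _) (sym (+-identityˡ _))
    ∑<-snoc f (suc n) = trans (+-congˡ (∑<-snoc (λ i → f (suc i)) n)) (sym (+-assoc _ _ _))

  *-distribˡ-∑< : (a : Carrier) (f : ℕ → Carrier) (n : ℕ) → a * ∑< f n ≈ ∑< (λ i → a * f i) n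
  *-distribˡ-∑< a f zero    = zeroʳ a
  *-distribˡ-∑< a f (suc n) = trans (distribˡ a _ _) (+-congˡ (*-distribˡ-∑< a (λ i → f (suc i)) n))

  *-distribʳ-∑< : (a : Carrier) (f : ℕ → Carrier) (n : ℕ) → ∑< f n * a ≈ ∑< (λ i → f i * a) n
  *-distribʳ-∑< a f n = trans (*-comm _ a) (trans (*-distribˡ-∑< a f n) (∑<-cong n (λ i _ → *-comm a (f i))))

  ∑<-+ : (f g : ℕ → Carrier) (n : ℕ) → ∑< (λ i → f i + g i) n ≈ ∑< f n + ∑< g n
  ∑<-+ f g zero    = sym (+-identityˡ 0#)
  ∑<-+ f g (suc n) = trans (+-congˡ (∑<-+ (λ i → f (suc i)) (λ i → g (suc i)) n)) (+-interchange _ _ _ _)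

  ∑<-minus : (f g : ℕ → Carrier) (n : ℕ) → ∑< (λ i → f i - g i) n ≈ ∑< f n - ∑< g n
  ∑<-minus f g n = trans (∑<-+ f (λ i → - g i) n) (+-congˡ (∑<-neg g n))
    where
    ∑<-neg : (g : ℕ → Carrier) (n : ℕ) → ∑< (λ i → - g i) n ≈ - ∑< g n
    ∑<-neg g zero    = sym -0#≈0#
    ∑<-neg g (suc n) = trans (+-congˡ (∑<-neg (λ i → g (suc i)) n)) (-‿+-comm _ _)

  ∑-∑<-comm : ∀ {a} {A : Set a} (f : A → ℕ → Carrier) (xs : List A) (n : ℕ) →
    ∑ (λ x → ∑< (f x) n) xs ≈ ∑< (λ i → ∑ (λ x → f x i) xs) n
  ∑-∑<-comm f xs zero    = ∑-zero _ xs (λ _ _ → refl)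
  ∑-∑<-comm f xs (suc n) =
    trans (∑-+ (λ x → f x 0) (λ x → ∑< (λ i → f x (suc i)) n) xs) (+-congˡ (∑-∑<-comm (λ x i → f x (suc i)) xs n))

  pow-+ : (a : Carrier) (m n : ℕ) → pow a (m ℕ.+ n) ≈ pow a m * pow a n
  pow-+ a zero    n = sym (*-identityˡ _)
  pow-+ a (suc m) n = trans (*-congˡ (pow-+ a m n)) (sym (*-assoc _ _ _))

module PermutationSums {c ℓ} (R : CommutativeRing c ℓ) (p q : CommutativeRing.Carrier R) where
  open CommutativeRing R
  open Series R
  open FiniteSums R
  open Insertion
  open Enumeration
  open CommutativeMonoidSolver *-commutativeMonoid using (solve; _⊜_; _⊕_)
  open import Relation.Binary.Reasoning.Setoid setoid
  open import Algebra.Properties.CommutativeSemigroup *-commutativeSemigroup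
    using (x∙yz≈y∙xz; xy∙z≈xz∙y; xy∙z≈zx∙y)

  invWeight : List ℕ → Carrier
  invWeight σ = pow q (inv σ) * pow p (coinv σ)

  -- Inserting n + 1 at position t of σ ∈ S_n creates n ∸ t inversions and t coinversions.
  insertWeight : ℕ → ℕ → Carrier
  insertWeight n t = pow q (n ∸ t) * pow p t

  ∑-perms-suc : (h : List ℕ → Carrier) (n : ℕ) →
    ∑ h (perms (suc n)) ≈ ∑ (λ σ → ∑< (λ t → h (insertAt t (suc n) σ)) (suc n)) (perms n)
  ∑-perms-suc h n = begin
    ∑ h (perms (suc n))
      ≈⟨ ∑-bijection h (perms (suc n)) (insertMax n) (cartesianProduct (perms n) (upTo (suc n)))
           (perms-unique (suc n)) (Unique.cartesianProduct⁺ (perms-unique n) (Unique.upTo⁺ (suc n)))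
           (insertMax-∈ n) (insertMax-surjective n) (insertMax-injective n) ⟩
    ∑ (λ y → h (insertMax n y)) (cartesianProduct (perms n) (upTo (suc n)))
      ≈⟨ ∑-cartesianProduct (λ y → h (insertMax n y)) (perms n) (upTo (suc n)) ⟩
    ∑ (λ σ → ∑ (λ t → h (insertAt t (suc n) σ)) (upTo (suc n))) (perms n)
      ≈⟨ ∑-cong (perms n) (λ σ → reflexive (∑-upTo (λ t → h (insertAt t (suc n) σ)) (suc n))) ⟩
    ∑ (λ σ → ∑< (λ t → h (insertAt t (suc n) σ)) (suc n)) (perms n) ∎

  invWeight-insertAt : ∀ n σ t → σ ∈ perms n → t ≤ n →
    invWeight (insertAt t (suc n) σ) ≈ invWeight σ * insertWeight n t
  invWeight-insertAt n σ t σ∈ t≤n with ∈-perms⁻ n σ σ∈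
  ... | len , inR , _ = begin
    pow q (inv (insertAt t (suc n) σ)) * pow p (coinv (insertAt t (suc n) σ))
      ≡⟨ cong₂ (λ a b → pow q a * pow p b)
               (≡.trans (inv-insertAt t (suc n) σ σ<n+1 t≤) (cong (λ l → inv σ ℕ.+ (l ∸ t)) len))
               (coinv-insertAt t (suc n) σ σ<n+1 t≤) ⟩
    pow q (inv σ ℕ.+ (n ∸ t)) * pow p (coinv σ ℕ.+ t)
      ≈⟨ *-cong (pow-+ q (inv σ) (n ∸ t)) (pow-+ p (coinv σ) t) ⟩
    (pow q (inv σ) * pow q (n ∸ t)) * (pow p (coinv σ) * pow p t)
      ≈⟨ solve 4 (λ a b c d → (a ⊕ b) ⊕ (c ⊕ d) ⊜ (a ⊕ c) ⊕ (b ⊕ d)) refl _ _ _ _ ⟩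
    invWeight σ * insertWeight n t ∎
    where
    σ<n+1 : All (_< suc n) σ
    σ<n+1 = All.map (λ inRange → s≤s (proj₂ inRange)) inR
    t≤ : t ≤ length σ
    t≤ = ≡.subst (t ≤_) (≡.sym len) t≤n

  qint≈∑<insertWeight : ∀ n → ∑< (insertWeight n) (suc n) ≈ qint p q (suc n)
  qint≈∑<insertWeight n = begin
    ∑< (insertWeight n) (suc n)                          ≈⟨ ∑<-reverse (insertWeight n) (suc n) ⟩
    ∑< (λ i → insertWeight n (n ∸ i)) (suc n)            ≈⟨ ∑<-cong (suc n) (λ i i≤n → trans
                                                              (reflexive (cong (λ j → pow q j * pow p (n ∸ i)) (ℕ.m∸[m∸n]≡n (ℕ.≤-pred i≤n))))
                                                              (*-comm _ _)) ⟩
    ∑< (λ i → pow p (n ∸ i) * pow q i) (suc n)            ≡⟨ ∑-upTo (λ i → pow p (n ∸ i) * pow q i) (suc n) ⟨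
    qint p q (suc n)                                     ∎

  ∑-invWeight : ∀ n → ∑ invWeight (perms n) ≈ qfact p q n
  ∑-invWeight zero    = trans (+-identityʳ _) (*-identityˡ _)
  ∑-invWeight (suc n) = begin
    ∑ invWeight (perms (suc n))                                        ≈⟨ ∑-perms-suc invWeight n ⟩
    ∑ (λ σ → ∑< (λ t → invWeight (insertAt t (suc n) σ)) (suc n)) (perms n)
      ≈⟨ ∑-cong-∈ (perms n) (λ σ σ∈ → trans (∑<-cong (suc n) (λ t t≤n → invWeight-insertAt n σ t σ∈ (ℕ.≤-pred t≤n)))
                                            (sym (*-distribˡ-∑< (invWeight σ) (insertWeight n) (suc n)))) ⟩
    ∑ (λ σ → invWeight σ * ∑< (insertWeight n) (suc n)) (perms n)        ≈⟨ *-distribʳ-∑ _ invWeight (perms n) ⟨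
    ∑ invWeight (perms n) * ∑< (insertWeight n) (suc n)                 ≈⟨ *-cong (∑-invWeight n) (qint≈∑<insertWeight n) ⟩
    qfact p q n * qint p q (suc n)                                     ≈⟨ *-comm _ _ ⟩
    qint p q (suc n) * qfact p q n                                     ∎

  -- The p,q-binomial coefficient of i + m over i; the recursion records whether the largest letter
  -- is inserted among the first i or among the last m positions.
  qbinom : ℕ → ℕ → Carrier
  qbinom zero    m       = 1#
  qbinom (suc i) zero    = 1#
  qbinom (suc i) (suc m) = pow q (suc m) * qbinom i (suc m) + pow p (suc i) * qbinom (suc i) m

  qbinom-zeroʳ : ∀ i → qbinom i 0 ≡ 1#
  qbinom-zeroʳ zero    = ≡.refl
  qbinom-zeroʳ (suc i) = ≡.refl

  splitTerm : ℕ → (List ℕ → List ℕ → Carrier) → List ℕ → Carrier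
  splitTerm i φ σ = φ (redP (take i σ)) (redP (drop i σ)) * invWeight σ

  blockSum : ℕ → ℕ → (List ℕ → List ℕ → Carrier) → Carrier
  blockSum i m φ = ∑ (λ τ → invWeight τ * ∑ (λ ρ → φ τ ρ * invWeight ρ) (perms m)) (perms i)

  insertSumˡ : ℕ → (List ℕ → List ℕ → Carrier) → List ℕ → List ℕ → Carrier
  insertSumˡ i φ τ ρ = ∑< (λ t → φ (insertAt t (suc i) τ) ρ * insertWeight i t) (suc i)

  insertSumʳ : ℕ → (List ℕ → List ℕ → Carrier) → List ℕ → List ℕ → Carrier
  insertSumʳ m φ τ ρ = ∑< (λ t → φ τ (insertAt t (suc m) ρ) * insertWeight m t) (suc m)

  blockSum-insertSumˡ : ∀ i m φ → blockSum i m (insertSumˡ i φ) ≈ blockSum (suc i) m φ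
  blockSum-insertSumˡ i m φ = begin
    ∑ (λ τ → invWeight τ * ∑ (λ ρ → insertSumˡ i φ τ ρ * invWeight ρ) (perms m)) (perms i)
      ≈⟨ ∑-cong-∈ (perms i) (λ τ τ∈ → trans (*-congˡ (inner τ))
           (trans (*-distribˡ-∑< (invWeight τ) (λ t → G (insertAt t (suc i) τ) * insertWeight i t) (suc i))
           (∑<-cong (suc i) (λ t t≤i → trans (x∙yz≈y∙xz (invWeight τ) (G (insertAt t (suc i) τ)) (insertWeight i t))
             (trans (*-congˡ (sym (invWeight-insertAt i τ t τ∈ (ℕ.≤-pred t≤i)))) (*-comm _ _)))))) ⟩
    ∑ (λ τ → ∑< (λ t → H (insertAt t (suc i) τ)) (suc i)) (perms i)        ≈⟨ ∑-perms-suc H i ⟨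
    ∑ H (perms (suc i))                                                    ∎
    where
    G : List ℕ → Carrier
    G τ = ∑ (λ ρ → φ τ ρ * invWeight ρ) (perms m)
    H : List ℕ → Carrier
    H τ = invWeight τ * G τ
    inner : ∀ τ → ∑ (λ ρ → insertSumˡ i φ τ ρ * invWeight ρ) (perms m) ≈ ∑< (λ t → G (insertAt t (suc i) τ) * insertWeight i t) (suc i)
    inner τ = begin
      ∑ (λ ρ → insertSumˡ i φ τ ρ * invWeight ρ) (perms m)
        ≈⟨ ∑-cong (perms m) (λ ρ → trans (*-distribʳ-∑< (invWeight ρ) (λ t → φ (insertAt t (suc i) τ) ρ * insertWeight i t) (suc i))
             (∑<-cong (suc i) (λ t _ → xy∙z≈xz∙y (φ (insertAt t (suc i) τ) ρ) (insertWeight i t) (invWeight ρ)))) ⟩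
      ∑ (λ ρ → ∑< (λ t → (φ (insertAt t (suc i) τ) ρ * invWeight ρ) * insertWeight i t) (suc i)) (perms m)
        ≈⟨ ∑-∑<-comm (λ ρ t → (φ (insertAt t (suc i) τ) ρ * invWeight ρ) * insertWeight i t) (perms m) (suc i) ⟩
      ∑< (λ t → ∑ (λ ρ → (φ (insertAt t (suc i) τ) ρ * invWeight ρ) * insertWeight i t) (perms m)) (suc i)
        ≈⟨ ∑<-cong (suc i) (λ t _ → sym (*-distribʳ-∑ (insertWeight i t) (λ ρ → φ (insertAt t (suc i) τ) ρ * invWeight ρ) (perms m))) ⟩
      ∑< (λ t → G (insertAt t (suc i) τ) * insertWeight i t) (suc i) ∎

  blockSum-insertSumʳ : ∀ i m φ → blockSum i m (insertSumʳ m φ) ≈ blockSum i (suc m) φ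
  blockSum-insertSumʳ i m φ = ∑-cong (perms i) (λ τ → *-congˡ (begin
    ∑ (λ ρ → insertSumʳ m φ τ ρ * invWeight ρ) (perms m)
      ≈⟨ ∑-cong-∈ (perms m) (λ ρ ρ∈ → trans (*-distribʳ-∑< (invWeight ρ) (λ t → φ τ (insertAt t (suc m) ρ) * insertWeight m t) (suc m))
           (∑<-cong (suc m) (λ t t≤m → trans (*-assoc (φ τ (insertAt t (suc m) ρ)) _ _)
             (*-congˡ (trans (*-comm _ _) (sym (invWeight-insertAt m ρ t ρ∈ (ℕ.≤-pred t≤m)))))))) ⟩
    ∑ (λ ρ → ∑< (λ t → φ τ (insertAt t (suc m) ρ) * invWeight (insertAt t (suc m) ρ)) (suc m)) (perms m)
      ≈⟨ ∑-perms-suc (λ ρ → φ τ ρ * invWeight ρ) m ⟨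
    ∑ (λ ρ → φ τ ρ * invWeight ρ) (perms (suc m)) ∎))

  private
    below : ∀ {n σ} → σ ∈ perms n → All (_< suc n) σ
    below {n} {σ} σ∈ = All.map (λ inRange → s≤s (proj₂ inRange)) (proj₁ (proj₂ (∈-perms⁻ n σ σ∈)))

    length-perm : ∀ {n σ} → σ ∈ perms n → length σ ≡ n
    length-perm {n} {σ} σ∈ = proj₁ (∈-perms⁻ n σ σ∈)

  splitTerm-insertAtˡ : ∀ n i m φ σ t → i ℕ.+ m ≡ n → σ ∈ perms n → t ≤ i →
    splitTerm (suc i) φ (insertAt t (suc n) σ)
      ≈ (φ (insertAt t (suc i) (redP (take i σ))) (redP (drop i σ)) * insertWeight i t * invWeight σ) * pow q m
  splitTerm-insertAtˡ n i m φ σ t i+m≡n σ∈ t≤i = begin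
    φ (redP (take (suc i) (insertAt t (suc n) σ))) (redP (drop (suc i) (insertAt t (suc n) σ))) * invWeight (insertAt t (suc n) σ)
      ≈⟨ *-cong (reflexive (cong₂ φ take≡ drop≡)) (invWeight-insertAt n σ t σ∈ (ℕ.≤-trans t≤i i≤n)) ⟩
    φ τ′ ρ * (invWeight σ * (pow q (n ∸ t) * pow p t))
      ≈⟨ *-congˡ (*-congˡ (*-congʳ (trans (reflexive (cong (pow q) n∸t≡)) (pow-+ q (i ∸ t) m)))) ⟩
    φ τ′ ρ * (invWeight σ * ((pow q (i ∸ t) * pow q m) * pow p t))
      ≈⟨ solve 5 (λ a w x y z → a ⊕ (w ⊕ ((x ⊕ y) ⊕ z)) ⊜ ((a ⊕ (x ⊕ z)) ⊕ w) ⊕ y) refl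
               (φ τ′ ρ) (invWeight σ) (pow q (i ∸ t)) (pow q m) (pow p t) ⟩
    (φ τ′ ρ * insertWeight i t * invWeight σ) * pow q m ∎
    where
    τ′ = insertAt t (suc i) (redP (take i σ))
    ρ = redP (drop i σ)
    i≤n : i ≤ n
    i≤n = ≡.subst (i ≤_) i+m≡n (ℕ.m≤m+n i m)
    take≡ : redP (take (suc i) (insertAt t (suc n) σ)) ≡ τ′
    take≡ = ≡.trans (cong redP (take-insertAt-≤ t i (suc n) σ t≤i))
              (≡.trans (redP-insertAt t (suc n) (take i σ) (Allₚ.take⁺ i (below σ∈)))
                       (cong (λ l → insertAt t (suc l) (redP (take i σ)))
                             (≡.trans (List.length-take i σ) (≡.trans (cong (i ℕ.⊓_) (length-perm σ∈)) (ℕ.m≤n⇒m⊓n≡m i≤n)))))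
    drop≡ : redP (drop (suc i) (insertAt t (suc n) σ)) ≡ ρ
    drop≡ = cong redP (drop-insertAt-≤ t i (suc n) σ t≤i)
    n∸t≡ : n ∸ t ≡ (i ∸ t) ℕ.+ m
    n∸t≡ = ≡.trans (cong (_∸ t) (≡.sym i+m≡n)) (ℕ.+-∸-comm m t≤i)

  splitTerm-insertAtʳ : ∀ n i m φ σ t → i ℕ.+ m ≡ n → σ ∈ perms n → t ≤ m →
    splitTerm i φ (insertAt (i ℕ.+ t) (suc n) σ)
      ≈ (φ (redP (take i σ)) (insertAt t (suc m) (redP (drop i σ))) * insertWeight m t * invWeight σ) * pow p i
  splitTerm-insertAtʳ n i m φ σ t i+m≡n σ∈ t≤m = begin
    φ (redP (take i (insertAt (i ℕ.+ t) (suc n) σ))) (redP (drop i (insertAt (i ℕ.+ t) (suc n) σ)))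
      * invWeight (insertAt (i ℕ.+ t) (suc n) σ)
      ≈⟨ *-cong (reflexive (cong₂ φ take≡ drop≡)) (invWeight-insertAt n σ (i ℕ.+ t) σ∈ i+t≤n) ⟩
    φ τ ρ′ * (invWeight σ * (pow q (n ∸ (i ℕ.+ t)) * pow p (i ℕ.+ t)))
      ≈⟨ *-congˡ (*-congˡ (*-cong (reflexive (cong (pow q) n∸i+t≡)) (pow-+ p i t))) ⟩
    φ τ ρ′ * (invWeight σ * (pow q (m ∸ t) * (pow p i * pow p t)))
      ≈⟨ solve 5 (λ a w x y z → a ⊕ (w ⊕ (x ⊕ (y ⊕ z))) ⊜ ((a ⊕ (x ⊕ z)) ⊕ w) ⊕ y) refl
               (φ τ ρ′) (invWeight σ) (pow q (m ∸ t)) (pow p i) (pow p t) ⟩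
    (φ τ ρ′ * insertWeight m t * invWeight σ) * pow p i ∎
    where
    τ = redP (take i σ)
    ρ′ = insertAt t (suc m) (redP (drop i σ))
    i≤len : i ≤ length σ
    i≤len = ≡.subst (i ≤_) (≡.trans i+m≡n (≡.sym (length-perm σ∈))) (ℕ.m≤m+n i m)
    take≡ : redP (take i (insertAt (i ℕ.+ t) (suc n) σ)) ≡ τ
    take≡ = cong redP (take-insertAt-+ i t (suc n) σ i≤len)
    drop≡ : redP (drop i (insertAt (i ℕ.+ t) (suc n) σ)) ≡ ρ′
    drop≡ = ≡.trans (cong redP (drop-insertAt-+ i t (suc n) σ i≤len))
              (≡.trans (redP-insertAt t (suc n) (drop i σ) (Allₚ.drop⁺ i (below σ∈)))
                       (cong (λ l → insertAt t (suc l) (redP (drop i σ)))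
                             (≡.trans (List.length-drop i σ)
                                      (≡.trans (cong (_∸ i) (≡.trans (length-perm σ∈) (≡.sym i+m≡n))) (ℕ.m+n∸m≡n i m)))))
    i+t≤n : i ℕ.+ t ≤ n
    i+t≤n = ≡.subst (i ℕ.+ t ≤_) i+m≡n (ℕ.+-monoʳ-≤ i t≤m)
    n∸i+t≡ : n ∸ (i ℕ.+ t) ≡ m ∸ t
    n∸i+t≡ = ≡.trans (cong (_∸ (i ℕ.+ t)) (≡.sym i+m≡n)) (ℕ.[m+n]∸[m+o]≡n∸o i m t)

  splitSum : ℕ → ℕ → (List ℕ → List ℕ → Carrier) → Carrier
  splitSum n i φ = ∑ (splitTerm i φ) (perms n)

  ∑-insertAtˡ : ∀ n i m φ → i ℕ.+ m ≡ n →
    ∑ (λ σ → ∑< (λ t → splitTerm (suc i) φ (insertAt t (suc n) σ)) (suc i)) (perms n) ≈ splitSum n i (insertSumˡ i φ) * pow q m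
  ∑-insertAtˡ n i m φ i+m≡n = trans (∑-cong-∈ (perms n) pointwise) (sym (*-distribʳ-∑ (pow q m) (splitTerm i (insertSumˡ i φ)) (perms n)))
    where
    pointwise : ∀ σ → σ ∈ perms n →
      ∑< (λ t → splitTerm (suc i) φ (insertAt t (suc n) σ)) (suc i) ≈ splitTerm i (insertSumˡ i φ) σ * pow q m
    pointwise σ σ∈ = begin
      ∑< (λ t → splitTerm (suc i) φ (insertAt t (suc n) σ)) (suc i)
        ≈⟨ ∑<-cong (suc i) (λ t t≤i → splitTerm-insertAtˡ n i m φ σ t i+m≡n σ∈ (ℕ.≤-pred t≤i)) ⟩
      ∑< (λ t → (X t * invWeight σ) * pow q m) (suc i)  ≈⟨ *-distribʳ-∑< (pow q m) (λ t → X t * invWeight σ) (suc i) ⟨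
      ∑< (λ t → X t * invWeight σ) (suc i) * pow q m    ≈⟨ *-congʳ (*-distribʳ-∑< (invWeight σ) X (suc i)) ⟨
      splitTerm i (insertSumˡ i φ) σ * pow q m           ∎
      where
      X : ℕ → Carrier
      X t = φ (insertAt t (suc i) (redP (take i σ))) (redP (drop i σ)) * insertWeight i t

  ∑-insertAtʳ : ∀ n i m φ → i ℕ.+ m ≡ n →
    ∑ (λ σ → ∑< (λ t → splitTerm i φ (insertAt (i ℕ.+ t) (suc n) σ)) (suc m)) (perms n) ≈ splitSum n i (insertSumʳ m φ) * pow p i
  ∑-insertAtʳ n i m φ i+m≡n = trans (∑-cong-∈ (perms n) pointwise) (sym (*-distribʳ-∑ (pow p i) (splitTerm i (insertSumʳ m φ)) (perms n)))
    where
    pointwise : ∀ σ → σ ∈ perms n →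
      ∑< (λ t → splitTerm i φ (insertAt (i ℕ.+ t) (suc n) σ)) (suc m) ≈ splitTerm i (insertSumʳ m φ) σ * pow p i
    pointwise σ σ∈ = begin
      ∑< (λ t → splitTerm i φ (insertAt (i ℕ.+ t) (suc n) σ)) (suc m)
        ≈⟨ ∑<-cong (suc m) (λ t t≤m → splitTerm-insertAtʳ n i m φ σ t i+m≡n σ∈ (ℕ.≤-pred t≤m)) ⟩
      ∑< (λ t → (X t * invWeight σ) * pow p i) (suc m)  ≈⟨ *-distribʳ-∑< (pow p i) (λ t → X t * invWeight σ) (suc m) ⟨
      ∑< (λ t → X t * invWeight σ) (suc m) * pow p i    ≈⟨ *-congʳ (*-distribʳ-∑< (invWeight σ) X (suc m)) ⟨
      splitTerm i (insertSumʳ m φ) σ * pow p i           ∎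
      where
      X : ℕ → Carrier
      X t = φ (redP (take i σ)) (insertAt t (suc m) (redP (drop i σ))) * insertWeight m t

  splitSum-suc : ∀ n i m φ → i ℕ.+ m ≡ suc n → splitSum (suc n) i φ
    ≈ ∑ (λ σ → ∑< (λ t → splitTerm i φ (insertAt t (suc n) σ)) i) (perms n)
      + ∑ (λ σ → ∑< (λ t → splitTerm i φ (insertAt (i ℕ.+ t) (suc n) σ)) m) (perms n)
  splitSum-suc n i m φ i+m≡ = begin
    splitSum (suc n) i φ                                  ≈⟨ ∑-perms-suc (splitTerm i φ) n ⟩
    ∑ (λ σ → ∑< (ins σ) (suc n)) (perms n)                ≈⟨ ∑-cong (perms n) (λ σ →
                                                               trans (reflexive (cong (∑< (ins σ)) (≡.sym i+m≡)))
                                                                     (∑<-split (ins σ) i m)) ⟩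
    ∑ (λ σ → ∑< (ins σ) i + ∑< (λ t → ins σ (i ℕ.+ t)) m) (perms n)
                                                          ≈⟨ ∑-+ (λ σ → ∑< (ins σ) i) (λ σ → ∑< (λ t → ins σ (i ℕ.+ t)) m) (perms n) ⟩
    ∑ (λ σ → ∑< (ins σ) i) (perms n) + ∑ (λ σ → ∑< (λ t → ins σ (i ℕ.+ t)) m) (perms n) ∎
    where
    ins : List ℕ → ℕ → Carrier
    ins σ t = splitTerm i φ (insertAt t (suc n) σ)

  -- Cutting σ ∈ S_n after position i, the reductions of the two pieces run over S_i × S_m, and the
  -- weight of σ is their product times that of a shuffle; summing the shuffles gives qbinom i m.
  SplitFormula : ℕ → Set (c ⊔ ℓ)
  SplitFormula n = ∀ i m → i ℕ.+ m ≡ n → ∀ φ → splitSum n i φ ≈ qbinom i m * blockSum i m φ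

  SplitFormula-suc : ∀ n → SplitFormula n → SplitFormula (suc n)
  SplitFormula-suc n IH zero (suc m) 1+m≡ φ = begin
    splitSum (suc n) 0 φ                               ≈⟨ splitSum-suc n 0 (suc m) φ 1+m≡ ⟩
    ∑ (λ _ → 0#) (perms n) + ∑ (λ σ → ∑< (λ t → splitTerm 0 φ (insertAt t (suc n) σ)) (suc m)) (perms n)
      ≈⟨ trans (+-congʳ (∑-zero (λ _ → 0#) (perms n) (λ _ _ → refl))) (+-identityˡ _) ⟩
    ∑ (λ σ → ∑< (λ t → splitTerm 0 φ (insertAt t (suc n) σ)) (suc m)) (perms n)
      ≈⟨ ∑-insertAtʳ n 0 m φ m≡n ⟩
    splitSum n 0 (insertSumʳ m φ) * 1#                 ≈⟨ *-identityʳ _ ⟩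
    splitSum n 0 (insertSumʳ m φ)                      ≈⟨ IH 0 m m≡n (insertSumʳ m φ) ⟩
    qbinom 0 m * blockSum 0 m (insertSumʳ m φ)         ≈⟨ *-congˡ (blockSum-insertSumʳ 0 m φ) ⟩
    qbinom 0 (suc m) * blockSum 0 (suc m) φ            ∎
    where
    m≡n : m ≡ n
    m≡n = ℕ.suc-injective 1+m≡
  SplitFormula-suc n IH (suc i) zero i+1≡ φ = begin
    splitSum (suc n) (suc i) φ                         ≈⟨ splitSum-suc n (suc i) 0 φ i+1≡ ⟩
    ∑ (λ σ → ∑< (λ t → splitTerm (suc i) φ (insertAt t (suc n) σ)) (suc i)) (perms n) + ∑ (λ _ → 0#) (perms n)
      ≈⟨ trans (+-congˡ (∑-zero (λ _ → 0#) (perms n) (λ _ _ → refl))) (+-identityʳ _) ⟩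
    ∑ (λ σ → ∑< (λ t → splitTerm (suc i) φ (insertAt t (suc n) σ)) (suc i)) (perms n)
      ≈⟨ ∑-insertAtˡ n i 0 φ i≡n ⟩
    splitSum n i (insertSumˡ i φ) * 1#                 ≈⟨ *-identityʳ _ ⟩
    splitSum n i (insertSumˡ i φ)                      ≈⟨ IH i 0 i≡n (insertSumˡ i φ) ⟩
    qbinom i 0 * blockSum i 0 (insertSumˡ i φ)         ≈⟨ *-cong (reflexive (qbinom-zeroʳ i)) (blockSum-insertSumˡ i 0 φ) ⟩
    1# * blockSum (suc i) 0 φ                          ∎
    where
    i≡n : i ℕ.+ 0 ≡ n
    i≡n = ℕ.suc-injective i+1≡
  SplitFormula-suc n IH (suc i) (suc m) i+m+2≡ φ = begin
    splitSum (suc n) (suc i) φ                         ≈⟨ splitSum-suc n (suc i) (suc m) φ i+m+2≡ ⟩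
    ∑ (λ σ → ∑< (λ t → splitTerm (suc i) φ (insertAt t (suc n) σ)) (suc i)) (perms n)
      + ∑ (λ σ → ∑< (λ t → splitTerm (suc i) φ (insertAt (suc i ℕ.+ t) (suc n) σ)) (suc m)) (perms n)
      ≈⟨ +-cong (∑-insertAtˡ n i (suc m) φ eqˡ) (∑-insertAtʳ n (suc i) m φ eqʳ) ⟩
    splitSum n i (insertSumˡ i φ) * pow q (suc m) + splitSum n (suc i) (insertSumʳ m φ) * pow p (suc i)
      ≈⟨ +-cong (*-congʳ (IH i (suc m) eqˡ (insertSumˡ i φ)))
                (*-congʳ (IH (suc i) m eqʳ (insertSumʳ m φ))) ⟩
    (qbinom i (suc m) * blockSum i (suc m) (insertSumˡ i φ)) * pow q (suc m)
      + (qbinom (suc i) m * blockSum (suc i) m (insertSumʳ m φ)) * pow p (suc i)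
      ≈⟨ +-cong (*-congʳ (*-congˡ (blockSum-insertSumˡ i (suc m) φ)))
                (*-congʳ (*-congˡ (blockSum-insertSumʳ (suc i) m φ))) ⟩
    (qbinom i (suc m) * S) * pow q (suc m) + (qbinom (suc i) m * S) * pow p (suc i)
      ≈⟨ +-cong (xy∙z≈zx∙y _ _ _) (xy∙z≈zx∙y _ _ _) ⟩
    (pow q (suc m) * qbinom i (suc m)) * S + (pow p (suc i) * qbinom (suc i) m) * S
      ≈⟨ distribʳ S _ _ ⟨
    qbinom (suc i) (suc m) * S ∎
    where
    S = blockSum (suc i) (suc m) φ
    eqˡ : i ℕ.+ suc m ≡ n
    eqˡ = ℕ.suc-injective i+m+2≡
    eqʳ : suc i ℕ.+ m ≡ n
    eqʳ = ℕ.suc-injective (≡.trans (≡.sym (ℕ.+-suc (suc i) m)) i+m+2≡)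


  ∑-splitTerm : ∀ n → SplitFormula n
  ∑-splitTerm zero zero zero _ φ = begin
    φ [] [] * invWeight [] + 0#                                ≈⟨ single ⟩
    φ [] []                                                    ≈⟨ single ⟨
    φ [] [] * invWeight [] + 0#                                ≈⟨ trans (*-congʳ (*-identityˡ 1#)) (*-identityˡ _) ⟨
    invWeight [] * (φ [] [] * invWeight [] + 0#)               ≈⟨ +-identityʳ _ ⟨
    blockSum 0 0 φ                                             ≈⟨ *-identityˡ _ ⟨
    qbinom 0 0 * blockSum 0 0 φ                                ∎
    where
    single : φ [] [] * invWeight [] + 0# ≈ φ [] []
    single = trans (+-identityʳ _) (trans (*-congˡ (*-identityˡ 1#)) (*-identityʳ _))
  ∑-splitTerm (suc n) = SplitFormula-suc n (∑-splitTerm n)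

  qfact-+ : ∀ i m → qfact p q (i ℕ.+ m) ≈ qbinom i m * (qfact p q i * qfact p q m)
  qfact-+ i m = begin
    qfact p q (i ℕ.+ m)                                ≈⟨ ∑-invWeight (i ℕ.+ m) ⟨
    ∑ invWeight (perms (i ℕ.+ m))                      ≈⟨ ∑-cong (perms (i ℕ.+ m)) (λ σ → *-identityˡ _) ⟨
    splitSum (i ℕ.+ m) i (λ _ _ → 1#)                  ≈⟨ ∑-splitTerm (i ℕ.+ m) i m ≡.refl (λ _ _ → 1#) ⟩
    qbinom i m * blockSum i m (λ _ _ → 1#)             ≈⟨ *-congˡ blockSum≈ ⟩
    qbinom i m * (qfact p q i * qfact p q m)           ∎
    where
    blockSum≈ : blockSum i m (λ _ _ → 1#) ≈ qfact p q i * qfact p q m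
    blockSum≈ = begin
      ∑ (λ τ → invWeight τ * ∑ (λ ρ → 1# * invWeight ρ) (perms m)) (perms i)
        ≈⟨ ∑-cong (perms i) (λ τ → *-congˡ (trans (∑-cong (perms m) (λ ρ → *-identityˡ _)) (∑-invWeight m))) ⟩
      ∑ (λ τ → invWeight τ * qfact p q m) (perms i)   ≈⟨ *-distribʳ-∑ (qfact p q m) invWeight (perms i) ⟨
      ∑ invWeight (perms i) * qfact p q m             ≈⟨ *-congʳ (∑-invWeight i) ⟩
      qfact p q i * qfact p q m                       ∎

module WreathSums {c ℓ} (R : CommutativeRing c ℓ) (p q r : CommutativeRing.Carrier R) (k : ℕ) where
  open CommutativeRing R
  open Series R
  open FiniteSums R
  open Enumeration
  open PermutationSums R p q
  open CommutativeMonoidSolver *-commutativeMonoid using (solve; _⊜_; _⊕_)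
  open import Relation.Binary.Reasoning.Setoid setoid

  private
    take-++ : ∀ (u v : List ℕ) → take (length u) (u ++ v) ≡ u
    take-++ []      v = ≡.refl
    take-++ (a ∷ u) v = cong (a ∷_) (take-++ u v)

    drop-++ : ∀ (u v : List ℕ) → drop (length u) (u ++ v) ≡ v
    drop-++ []      v = ≡.refl
    drop-++ (a ∷ u) v = drop-++ u v

    ‖++‖ : ∀ (u v : List ℕ) → ‖ u ++ v ‖ ≡ ‖ u ‖ ℕ.+ ‖ v ‖
    ‖++‖ []      v = ≡.refl
    ‖++‖ (a ∷ u) v = ≡.trans (cong (a ℕ.+_) (‖++‖ u v)) (≡.sym (ℕ.+-assoc a ‖ u ‖ ‖ v ‖))

  ∑-words-+ : ∀ i m (h : List ℕ → Carrier) →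
    ∑ h (words k (i ℕ.+ m)) ≈ ∑ (λ u → ∑ (λ v → h (u ++ v)) (words k m)) (words k i)
  ∑-words-+ zero    m h = sym (+-identityʳ _)
  ∑-words-+ (suc i) m h = begin
    ∑ h (words k (suc (i ℕ.+ m)))                                      ≡⟨ cong (∑ h) (words-suc k (i ℕ.+ m)) ⟩
    ∑ h (cartesianProductWith _∷_ (upTo k) (words k (i ℕ.+ m)))        ≈⟨ ∑-cartesianProductWith h _∷_ (upTo k) (words k (i ℕ.+ m)) ⟩
    ∑ (λ a → ∑ (λ w → h (a ∷ w)) (words k (i ℕ.+ m))) (upTo k)         ≈⟨ ∑-cong (upTo k) (λ a → ∑-words-+ i m (λ w → h (a ∷ w))) ⟩
    ∑ (λ a → ∑ (λ u → H (a ∷ u)) (words k i)) (upTo k)                 ≈⟨ ∑-cartesianProductWith H _∷_ (upTo k) (words k i) ⟨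
    ∑ H (cartesianProductWith _∷_ (upTo k) (words k i))                ≡⟨ cong (∑ H) (words-suc k i) ⟨
    ∑ H (words k (suc i))                                               ∎
    where
    H : List ℕ → Carrier
    H u = ∑ (λ v → h (u ++ v)) (words k m)

  wreathWeight : List ℕ × List ℕ → Carrier
  wreathWeight = weightA p q r

  colourSum : ℕ → (List ℕ × List ℕ → Carrier) → List ℕ → Carrier
  colourSum n f τ = ∑ (λ u → f (τ , u) * pow r ‖ u ‖) (words k n)

  ∑-wreath : ∀ n (f : List ℕ × List ℕ → Carrier) →
    ∑ (λ s → f s * wreathWeight s) (wreath k n) ≈ ∑ (λ τ → colourSum n f τ * invWeight τ) (perms n)
  ∑-wreath n f = trans (∑-cartesianProduct (λ s → f s * wreathWeight s) (perms n) (words k n))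
    (∑-cong (perms n) (λ τ → trans
      (∑-cong (words k n) (λ u → solve 3 (λ a w x → a ⊕ (w ⊕ x) ⊜ (a ⊕ x) ⊕ w) refl (f (τ , u)) (invWeight τ) (pow r ‖ u ‖)))
      (sym (*-distribʳ-∑ (invWeight τ) (λ u → f (τ , u) * pow r ‖ u ‖) (words k n)))))

  blockSum-colourSum : ∀ i m (f g : List ℕ × List ℕ → Carrier) →
    blockSum i m (λ τ ρ → colourSum i f τ * colourSum m g ρ)
      ≈ ∑ (λ s → f s * wreathWeight s) (wreath k i) * ∑ (λ s → g s * wreathWeight s) (wreath k m)
  blockSum-colourSum i m f g = begin
    ∑ (λ τ → invWeight τ * ∑ (λ ρ → (colourSum i f τ * colourSum m g ρ) * invWeight ρ) (perms m)) (perms i)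
      ≈⟨ ∑-cong (perms i) (λ τ → *-congˡ (trans (∑-cong (perms m) (λ ρ → *-assoc _ _ _))
                                               (sym (*-distribˡ-∑ (colourSum i f τ) (λ ρ → colourSum m g ρ * invWeight ρ) (perms m))))) ⟩
    ∑ (λ τ → invWeight τ * (colourSum i f τ * G)) (perms i)
      ≈⟨ ∑-cong (perms i) (λ τ → solve 3 (λ w x y → w ⊕ (x ⊕ y) ⊜ (x ⊕ w) ⊕ y) refl (invWeight τ) (colourSum i f τ) G) ⟩
    ∑ (λ τ → (colourSum i f τ * invWeight τ) * G) (perms i)   ≈⟨ *-distribʳ-∑ G (λ τ → colourSum i f τ * invWeight τ) (perms i) ⟨
    ∑ (λ τ → colourSum i f τ * invWeight τ) (perms i) * G     ≈⟨ *-cong (∑-wreath i f) (∑-wreath m g) ⟨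
    ∑ (λ s → f s * wreathWeight s) (wreath k i) * ∑ (λ s → g s * wreathWeight s) (wreath k m) ∎
    where
    G = ∑ (λ ρ → colourSum m g ρ * invWeight ρ) (perms m)

  splitWreathTerm : ℕ → (f g : List ℕ × List ℕ → Carrier) → List ℕ × List ℕ → Carrier
  splitWreathTerm i f g (σ , w) = f (redP (take i σ) , take i w) * g (redP (drop i σ) , drop i w) * wreathWeight (σ , w)

  ∑-words-splitWreathTerm : ∀ i m (f g : List ℕ × List ℕ → Carrier) σ →
    ∑ (λ w → splitWreathTerm i f g (σ , w)) (words k (i ℕ.+ m))
      ≈ splitTerm i (λ τ ρ → colourSum i f τ * colourSum m g ρ) σ
  ∑-words-splitWreathTerm i m f g σ = begin
    ∑ (λ w → splitWreathTerm i f g (σ , w)) (words k (i ℕ.+ m))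
      ≈⟨ ∑-words-+ i m (λ w → splitWreathTerm i f g (σ , w)) ⟩
    ∑ (λ u → ∑ (λ v → splitWreathTerm i f g (σ , u ++ v)) (words k m)) (words k i)
      ≈⟨ ∑-cong-∈ (words k i) (λ u u∈ → ∑-cong (words k m) (λ v → concatenate u v (proj₁ (∈-words⁻ k i u u∈)))) ⟩
    ∑ (λ u → ∑ (λ v → (F u * G v) * invWeight σ) (words k m)) (words k i)
      ≈⟨ ∑-cong (words k i) (λ u → *-distribʳ-∑ (invWeight σ) (λ v → F u * G v) (words k m)) ⟨
    ∑ (λ u → ∑ (λ v → F u * G v) (words k m) * invWeight σ) (words k i)
      ≈⟨ *-distribʳ-∑ (invWeight σ) (λ u → ∑ (λ v → F u * G v) (words k m)) (words k i) ⟨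
    ∑ (λ u → ∑ (λ v → F u * G v) (words k m)) (words k i) * invWeight σ
      ≈⟨ *-congʳ (∑-product F G (words k i) (words k m)) ⟩
    splitTerm i (λ τ ρ → colourSum i f τ * colourSum m g ρ) σ ∎
    where
    F G : List ℕ → Carrier
    F u = f (redP (take i σ) , u) * pow r ‖ u ‖
    G v = g (redP (drop i σ) , v) * pow r ‖ v ‖
    concatenate : ∀ u v → length u ≡ i → splitWreathTerm i f g (σ , u ++ v) ≈ (F u * G v) * invWeight σ
    concatenate u v ≡.refl = begin
      f (redP (take (length u) σ) , take (length u) (u ++ v)) * g (redP (drop (length u) σ) , drop (length u) (u ++ v))
        * (invWeight σ * pow r ‖ u ++ v ‖)
        ≡⟨ cong₂ (λ u′ v′ → f (redP (take (length u) σ) , u′) * g (redP (drop (length u) σ) , v′) * (invWeight σ * pow r ‖ u ++ v ‖))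
                 (take-++ u v) (drop-++ u v) ⟩
      f (redP (take (length u) σ) , u) * g (redP (drop (length u) σ) , v) * (invWeight σ * pow r ‖ u ++ v ‖)
        ≈⟨ *-congˡ (*-congˡ (trans (reflexive (cong (pow r) (‖++‖ u v))) (pow-+ r ‖ u ‖ ‖ v ‖))) ⟩
      f (redP (take (length u) σ) , u) * g (redP (drop (length u) σ) , v) * (invWeight σ * (pow r ‖ u ‖ * pow r ‖ v ‖))
        ≈⟨ solve 5 (λ a b w x y → (a ⊕ b) ⊕ (w ⊕ (x ⊕ y)) ⊜ ((a ⊕ x) ⊕ (b ⊕ y)) ⊕ w) refl _ _ _ _ _ ⟩
      (F u * G v) * invWeight σ ∎

  ∑-wreath-split : ∀ i m (f g : List ℕ × List ℕ → Carrier) →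
    ∑ (splitWreathTerm i f g) (wreath k (i ℕ.+ m))
      ≈ qbinom i m * (∑ (λ s → f s * wreathWeight s) (wreath k i) * ∑ (λ s → g s * wreathWeight s) (wreath k m))
  ∑-wreath-split i m f g = begin
    ∑ (splitWreathTerm i f g) (wreath k (i ℕ.+ m))
      ≈⟨ ∑-cartesianProduct (splitWreathTerm i f g) (perms (i ℕ.+ m)) (words k (i ℕ.+ m)) ⟩
    ∑ (λ σ → ∑ (λ w → splitWreathTerm i f g (σ , w)) (words k (i ℕ.+ m))) (perms (i ℕ.+ m))
      ≈⟨ ∑-cong (perms (i ℕ.+ m)) (∑-words-splitWreathTerm i m f g) ⟩
    splitSum (i ℕ.+ m) i φ                                     ≈⟨ ∑-splitTerm (i ℕ.+ m) i m ≡.refl φ ⟩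
    qbinom i m * blockSum i m φ                                ≈⟨ *-congˡ (blockSum-colourSum i m f g) ⟩
    qbinom i m * (∑ (λ s → f s * wreathWeight s) (wreath k i) * ∑ (λ s → g s * wreathWeight s) (wreath k m)) ∎
    where
    φ : List ℕ → List ℕ → Carrier
    φ τ ρ = colourSum i f τ * colourSum m g ρ

module PowerSeries {c ℓ} (R : CommutativeRing c ℓ) where
  open CommutativeRing R
  open Series R
  open FiniteSums R
  open import Relation.Binary.Reasoning.Setoid setoid
  open import Algebra.Properties.Ring ring using (x[y-z]≈xy-xz)

  *PS≡∑< : ∀ F G n → (F *PS G) n ≡ ∑< (λ i → F i * G (n ∸ i)) (suc n)
  *PS≡∑< F G n = ∑-upTo (λ i → F i * G (n ∸ i)) (suc n)

  *PS-comm : ∀ F G → (F *PS G) ≈PS (G *PS F)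
  *PS-comm F G n = begin
    (F *PS G) n                                  ≡⟨ *PS≡∑< F G n ⟩
    ∑< (λ i → F i * G (n ∸ i)) (suc n)           ≈⟨ ∑<-reverse (λ i → F i * G (n ∸ i)) (suc n) ⟩
    ∑< (λ i → F (n ∸ i) * G (n ∸ (n ∸ i))) (suc n)
      ≈⟨ ∑<-cong (suc n) (λ i i≤n → trans (*-comm (F (n ∸ i)) _) (*-congʳ (reflexive (≡.cong G (ℕ.m∸[m∸n]≡n (ℕ.≤-pred i≤n)))))) ⟩
    ∑< (λ i → G i * F (n ∸ i)) (suc n)           ≡⟨ *PS≡∑< G F n ⟨
    (G *PS F) n                                  ∎

  constPS-*PS : ∀ a F → (constPS a *PS F) ≈PS (λ n → a * F n)
  constPS-*PS a F n = begin
    (constPS a *PS F) n                                   ≡⟨ *PS≡∑< (constPS a) F n ⟩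
    a * F n + ∑< (λ i → 0# * F (n ∸ suc i)) n             ≈⟨ +-congˡ (∑<-zero _ n (λ i _ → zeroˡ _)) ⟩
    a * F n + 0#                                          ≈⟨ +-identityʳ _ ⟩
    a * F n                                               ∎

  *PS-cong : ∀ {F F′ G G′} → F ≈PS F′ → G ≈PS G′ → (F *PS G) ≈PS (F′ *PS G′)
  *PS-cong {F} {F′} {G} {G′} F≈ G≈ n = begin
    (F *PS G) n                                ≡⟨ *PS≡∑< F G n ⟩
    ∑< (λ i → F i * G (n ∸ i)) (suc n)         ≈⟨ ∑<-cong (suc n) (λ i _ → *-cong (F≈ i) (G≈ (n ∸ i))) ⟩
    ∑< (λ i → F′ i * G′ (n ∸ i)) (suc n)       ≡⟨ *PS≡∑< F′ G′ n ⟨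
    (F′ *PS G′) n                              ∎

  *PS-constPS-1 : ∀ F → (F *PS constPS 1#) ≈PS F
  *PS-constPS-1 F = trans′ (*PS-comm F (constPS 1#)) (λ n → trans (constPS-*PS 1# F n) (*-identityˡ _))
    where
    trans′ : ∀ {F G H} → F ≈PS G → G ≈PS H → F ≈PS H
    trans′ F≈G G≈H n = trans (F≈G n) (G≈H n)

  *PS-distribˡ-minus : ∀ F G H → (F *PS (G -PS H)) ≈PS ((F *PS G) -PS (F *PS H))
  *PS-distribˡ-minus F G H n = begin
    (F *PS (G -PS H)) n                                                ≡⟨ *PS≡∑< F (G -PS H) n ⟩
    ∑< (λ i → F i * (G (n ∸ i) - H (n ∸ i))) (suc n)                   ≈⟨ ∑<-cong (suc n) (λ i _ → x[y-z]≈xy-xz (F i) (G (n ∸ i)) (H (n ∸ i))) ⟩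
    ∑< (λ i → F i * G (n ∸ i) - F i * H (n ∸ i)) (suc n)              ≈⟨ ∑<-minus (λ i → F i * G (n ∸ i)) (λ i → F i * H (n ∸ i)) (suc n) ⟩
    ∑< (λ i → F i * G (n ∸ i)) (suc n) - ∑< (λ i → F i * H (n ∸ i)) (suc n)
                                                                       ≡⟨ ≡.cong₂ _-_ (*PS≡∑< F G n) (*PS≡∑< F H n) ⟨
    ((F *PS G) -PS (F *PS H)) n                                        ∎

  *PS-scaleˡ : ∀ a F G → ((λ m → a * F m) *PS G) ≈PS (λ n → a * (F *PS G) n)
  *PS-scaleˡ a F G n = begin
    ((λ m → a * F m) *PS G) n                  ≡⟨ *PS≡∑< (λ m → a * F m) G n ⟩
    ∑< (λ i → a * F i * G (n ∸ i)) (suc n)     ≈⟨ ∑<-cong (suc n) (λ i _ → *-assoc a (F i) (G (n ∸ i))) ⟩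
    ∑< (λ i → a * (F i * G (n ∸ i))) (suc n)   ≈⟨ *-distribˡ-∑< a (λ i → F i * G (n ∸ i)) (suc n) ⟨
    a * ∑< (λ i → F i * G (n ∸ i)) (suc n)     ≡⟨ ≡.cong (a *_) (*PS≡∑< F G n) ⟨
    a * (F *PS G) n                            ∎

  F≈A+aEF⇒F[1-aE]≈A : ∀ a E F A → (∀ n → F n ≈ A n + a * (E *PS F) n) →
    (F *PS (constPS 1# -PS (constPS a *PS E))) ≈PS A
  F≈A+aEF⇒F[1-aE]≈A a E F A F≈ n = begin
    (F *PS (constPS 1# -PS (constPS a *PS E))) n              ≈⟨ *PS-distribˡ-minus F (constPS 1#) (constPS a *PS E) n ⟩
    (F *PS constPS 1#) n - (F *PS (constPS a *PS E)) n        ≈⟨ +-cong (*PS-constPS-1 F n) (-‿cong aEF) ⟩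
    F n - a * (E *PS F) n                                    ≈⟨ +-congʳ (F≈ n) ⟩
    (A n + a * (E *PS F) n) - a * (E *PS F) n                ≈⟨ +-assoc _ _ _ ⟩
    A n + (a * (E *PS F) n - a * (E *PS F) n)                ≈⟨ +-congˡ (-‿inverseʳ _) ⟩
    A n + 0#                                                 ≈⟨ +-identityʳ _ ⟩
    A n                                                      ∎
    where
    aEF : (F *PS (constPS a *PS E)) n ≈ a * (E *PS F) n
    aEF = trans (*PS-comm F (constPS a *PS E) n)
                (trans (*PS-cong {G = F} {G′ = F} (constPS-*PS a E) (λ _ → refl) n) (*PS-scaleˡ a E F n))

module GeneratingFunction {c ℓ} (R : CommutativeRing c ℓ) (k j : ℕ) (1≤j : 1 ≤ j) (Υ : Pattern)
  (x p q r : CommutativeRing.Carrier R) (d : ℕ → CommutativeRing.Carrier R)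
  (d-inverse : ∀ n → CommutativeRing._≈_ R (CommutativeRing._*_ R (Series.qfact R p q n) (d n)) (CommutativeRing.1# R)) where
  open CommutativeRing R
  open Series R
  open FiniteSums R
  open Enumeration
  open PermutationSums R p q
  open WreathSums R p q r k
  open Matches Υ j
  open FirstMatch Υ j 1≤j
  open PowerSeries R
  open import Relation.Binary.Reasoning.Setoid setoid
  open CommutativeMonoidSolver *-commutativeMonoid using (solve; _⊜_; _⊕_)
  open import Algebra.Properties.CommutativeSemigroup *-commutativeSemigroup using (x∙yz≈y∙xz)
  open import Algebra.Properties.Ring ring using (x[y-z]≈xy-xz; -0#≈0#; -1*x≈-x)

  private
    length-wreath : ∀ {n σ w} → (σ , w) ∈ wreath k n → length σ ≡ n
    length-wreath {n} {σ} σw∈ = proj₁ (∈-perms⁻ n σ (proj₁ (∈-cartesianProduct⁻ (perms n) (words k n) σw∈)))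

  suffixPacking : List ℕ → List ℕ → ℕ → Carrier
  suffixPacking σ w e = 𝟙 (firstMatchAtEnd (prefix σ w e)) * pow x (nlap Υ j (redP (drop e σ)) (drop e w))

  pow-nlap-decomposition : ∀ σ w →
    pow x (nlap Υ j σ w) ≈ 𝟙 (matchFree σ w) + x * ∑< (suffixPacking σ w) (suc (length σ))
  pow-nlap-decomposition σ w with matchFree σ w in free
  ... | true = begin
    pow x (nlap Υ j σ w)                            ≡⟨ cong (pow x) (nlap-matchFree σ w free) ⟩
    1#                                              ≈⟨ +-identityʳ 1# ⟨
    1# + 0#                                         ≈⟨ +-congˡ (zeroʳ x) ⟨
    1# + x * 0#                                     ≈⟨ +-congˡ (*-congˡ (∑<-zero _ (suc (length σ)) (λ e e≤ →
                                                         trans (*-congʳ (reflexive (cong 𝟙 (firstMatchAtEnd-matchFree σ w free e (ℕ.≤-pred e≤)))))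
                                                               (zeroˡ (pow x (nlap Υ j (redP (drop e σ)) (drop e w))))))) ⟨
    1# + x * ∑< (suffixPacking σ w) (suc (length σ)) ∎
  ... | false with firstMatch-decomposition σ w free
  ...   | e₀ , e₀≤ , atEnd , elsewhere , nlap≡ = begin
    pow x (nlap Υ j σ w)                            ≡⟨ cong (pow x) nlap≡ ⟩
    x * pow x (nlap Υ j (redP (drop e₀ σ)) (drop e₀ w))
                                                    ≈⟨ *-congˡ (trans (*-congʳ (reflexive (cong 𝟙 atEnd))) (*-identityˡ _)) ⟨
    x * suffixPacking σ w e₀                        ≈⟨ *-congˡ (∑<-single (suffixPacking σ w) (suc (length σ)) e₀ (s≤s e₀≤) (λ e e≤ e≢e₀ →
                                                         trans (*-congʳ (reflexive (cong 𝟙 (elsewhere e (ℕ.≤-pred e≤) e≢e₀))))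
                                                               (zeroˡ (pow x (nlap Υ j (redP (drop e σ)) (drop e w)))))) ⟨
    x * ∑< (suffixPacking σ w) (suc (length σ))      ≈⟨ +-identityˡ _ ⟨
    0# + x * ∑< (suffixPacking σ w) (suc (length σ)) ∎

  matchFreeSum packingSum firstMatchSum : ℕ → Carrier
  matchFreeSum n  = ∑ (λ s → 𝟙 (matchFree (proj₁ s) (proj₂ s)) * wreathWeight s) (wreath k n)
  packingSum n    = ∑ (λ s → pow x (nlap Υ j (proj₁ s) (proj₂ s)) * wreathWeight s) (wreath k n)
  firstMatchSum n = ∑ (λ s → 𝟙 (firstMatchAtEnd s) * wreathWeight s) (wreath k n)

  packingSum-recursion : ∀ n →
    packingSum n ≈ matchFreeSum n + x * ∑< (λ e → qbinom e (n ∸ e) * (firstMatchSum e * packingSum (n ∸ e))) (suc n)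
  packingSum-recursion n = begin
    packingSum n
      ≈⟨ ∑-cong-∈ (wreath k n) (λ { (σ , w) σw∈ → distribute σ w (length-wreath σw∈) }) ⟩
    ∑ (λ s → 𝟙 (matchFree (proj₁ s) (proj₂ s)) * wreathWeight s + x * ∑< (λ e → suffixTerm e s) (suc n)) (wreath k n)
      ≈⟨ ∑-+ _ (λ s → x * ∑< (λ e → suffixTerm e s) (suc n)) (wreath k n) ⟩
    matchFreeSum n + ∑ (λ s → x * ∑< (λ e → suffixTerm e s) (suc n)) (wreath k n)
      ≈⟨ +-congˡ (*-distribˡ-∑ x (λ s → ∑< (λ e → suffixTerm e s) (suc n)) (wreath k n)) ⟨
    matchFreeSum n + x * ∑ (λ s → ∑< (λ e → suffixTerm e s) (suc n)) (wreath k n)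
      ≈⟨ +-congˡ (*-congˡ (∑-∑<-comm (λ s e → suffixTerm e s) (wreath k n) (suc n))) ⟩
    matchFreeSum n + x * ∑< (λ e → ∑ (suffixTerm e) (wreath k n)) (suc n)
      ≈⟨ +-congˡ (*-congˡ (∑<-cong (suc n) (λ e e≤n → split e (ℕ.≤-pred e≤n)))) ⟩
    matchFreeSum n + x * ∑< (λ e → qbinom e (n ∸ e) * (firstMatchSum e * packingSum (n ∸ e))) (suc n) ∎
    where
    suffixTerm : ℕ → List ℕ × List ℕ → Carrier
    suffixTerm e (σ , w) = suffixPacking σ w e * wreathWeight (σ , w)
    distribute : ∀ σ w → length σ ≡ n → pow x (nlap Υ j σ w) * wreathWeight (σ , w)
      ≈ 𝟙 (matchFree σ w) * wreathWeight (σ , w) + x * ∑< (λ e → suffixTerm e (σ , w)) (suc n)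
    distribute σ w ≡.refl = begin
      pow x (nlap Υ j σ w) * W
        ≈⟨ *-congʳ (pow-nlap-decomposition σ w) ⟩
      (𝟙 (matchFree σ w) + x * ∑< (suffixPacking σ w) (suc (length σ))) * W
        ≈⟨ distribʳ W _ _ ⟩
      𝟙 (matchFree σ w) * W + (x * ∑< (suffixPacking σ w) (suc (length σ))) * W
        ≈⟨ +-congˡ (trans (*-assoc _ _ _) (*-congˡ (*-distribʳ-∑< W (suffixPacking σ w) (suc (length σ))))) ⟩
      𝟙 (matchFree σ w) * W + x * ∑< (λ e → suffixTerm e (σ , w)) (suc (length σ)) ∎
      where W = wreathWeight (σ , w)
    split : ∀ e → e ≤ n → ∑ (suffixTerm e) (wreath k n) ≈ qbinom e (n ∸ e) * (firstMatchSum e * packingSum (n ∸ e))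
    split e e≤n = trans (reflexive (cong (λ m → ∑ (suffixTerm e) (wreath k m)) (≡.sym (ℕ.m+[n∸m]≡n e≤n))))
                        (∑-wreath-split e (n ∸ e) (λ t → 𝟙 (firstMatchAtEnd t)) (λ t → pow x (nlap Υ j (proj₁ t) (proj₂ t))))

  ∑-wreath-1 : ∑ (λ s → 1# * wreathWeight s) (wreath k 1) ≈ rint r k
  ∑-wreath-1 = begin
    ∑ (λ s → 1# * wreathWeight s) (wreath k 1)           ≈⟨ ∑-cartesianProduct (λ s → 1# * wreathWeight s) (perms 1) (words k 1) ⟩
    ∑ (λ w → 1# * wreathWeight (1 ∷ [] , w)) (words k 1) + 0#
                                                         ≈⟨ +-identityʳ _ ⟩
    ∑ (λ w → 1# * wreathWeight (1 ∷ [] , w)) (words k 1) ≡⟨ cong (∑ (λ w → 1# * wreathWeight (1 ∷ [] , w))) (words-suc k 0) ⟩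
    ∑ (λ w → 1# * wreathWeight (1 ∷ [] , w)) (cartesianProductWith _∷_ (upTo k) (words k 0))
                                                         ≈⟨ ∑-cartesianProductWith _ _∷_ (upTo k) (words k 0) ⟩
    ∑ (λ a → 1# * wreathWeight (1 ∷ [] , a ∷ []) + 0#) (upTo k)
                                                         ≈⟨ ∑-cong (upTo k) (λ a → trans (+-identityʳ _) (trans (*-identityˡ _)
                                                              (trans (*-congʳ (*-identityˡ _)) (trans (*-identityˡ _)
                                                                (reflexive (cong (pow r) (ℕ.+-identityʳ a))))))) ⟩
    ∑ (pow r) (upTo k)                                    ∎

  -- Appending a letter to a match-free object of size e yields an object that is either match-free
  -- or has its first bi-match at the end.
  firstMatchSum-recursion : ∀ e → firstMatchSum (suc e) + matchFreeSum (suc e) ≈ qbinom e 1 * (matchFreeSum e * rint r k)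
  firstMatchSum-recursion e = begin
    firstMatchSum (suc e) + matchFreeSum (suc e)
      ≈⟨ ∑-+ (λ s → 𝟙 (firstMatchAtEnd s) * wreathWeight s) (λ s → 𝟙 (matchFree (proj₁ s) (proj₂ s)) * wreathWeight s) (wreath k (suc e)) ⟨
    ∑ (λ s → 𝟙 (firstMatchAtEnd s) * wreathWeight s + 𝟙 (matchFree (proj₁ s) (proj₂ s)) * wreathWeight s) (wreath k (suc e))
      ≈⟨ ∑-cong-∈ (wreath k (suc e)) (λ { (σ , w) σw∈ → pointwise σ w (length-wreath σw∈) }) ⟩
    ∑ H (wreath k (suc e))                                  ≡⟨ cong (λ m → ∑ H (wreath k m)) (ℕ.+-comm 1 e) ⟩
    ∑ H (wreath k (e ℕ.+ 1))                                ≈⟨ ∑-wreath-split e 1 (λ t → 𝟙 (matchFree (proj₁ t) (proj₂ t))) (λ _ → 1#) ⟩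
    qbinom e 1 * (matchFreeSum e * ∑ (λ s → 1# * wreathWeight s) (wreath k 1))
                                                            ≈⟨ *-congˡ (*-congˡ ∑-wreath-1) ⟩
    qbinom e 1 * (matchFreeSum e * rint r k)                ∎
    where
    H : List ℕ × List ℕ → Carrier
    H s = 𝟙 (matchFree (redP (take e (proj₁ s))) (take e (proj₂ s))) * 1# * wreathWeight s
    𝟙-split : ∀ P Q W → (Q ≡ true → P ≡ true) → 𝟙 (P ∧ not Q) * W + 𝟙 Q * W ≈ 𝟙 P * 1# * W
    𝟙-split P     true  W Q⇒P rewrite Q⇒P ≡.refl = trans (+-congʳ (zeroˡ W)) (trans (+-identityˡ _) (*-congʳ (sym (*-identityʳ 1#))))
    𝟙-split true  false W _ = trans (+-congˡ (zeroˡ W)) (trans (+-identityʳ _) (*-congʳ (sym (*-identityʳ 1#))))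
    𝟙-split false false W _ = trans (+-congˡ (zeroˡ W)) (trans (+-identityʳ _) (*-congʳ (sym (zeroˡ 1#))))
    pointwise : ∀ σ w → length σ ≡ suc e →
      𝟙 (firstMatchAtEnd (σ , w)) * wreathWeight (σ , w) + 𝟙 (matchFree σ w) * wreathWeight (σ , w) ≈ H (σ , w)
    pointwise σ w len = begin
      𝟙 (firstMatchAtEnd (σ , w)) * W + 𝟙 (matchFree σ w) * W
        ≡⟨ cong (λ l → 𝟙 (matchFree (take (pred l) σ) (take (pred l) w) ∧ not (matchFree σ w)) * W + 𝟙 (matchFree σ w) * W) len ⟩
      𝟙 (matchFree (take e σ) (take e w) ∧ not (matchFree σ w)) * W + 𝟙 (matchFree σ w) * W
        ≈⟨ 𝟙-split (matchFree (take e σ) (take e w)) (matchFree σ w) W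
                   (matchFree-take σ w e (≡.subst (e ≤_) (≡.sym len) (ℕ.n≤1+n e))) ⟩
      𝟙 (matchFree (take e σ) (take e w)) * 1# * W
        ≡⟨ cong (λ b → 𝟙 b * 1# * W) (≡.sym (matchFree-redP (take e σ) (take e w))) ⟩
      H (σ , w) ∎
      where W = wreathWeight (σ , w)

  d-0 : d 0 ≈ 1#
  d-0 = trans (sym (*-identityˡ _)) (d-inverse 0)

  d-1 : d 1 ≈ 1#
  d-1 = trans (sym (trans (*-congʳ qfact-1) (*-identityˡ _))) (d-inverse 1)
    where
    qfact-1 : qfact p q 1 ≈ 1#
    qfact-1 = trans (*-identityʳ _) (trans (+-identityʳ _) (*-identityˡ _))

  d-qbinom : ∀ e m → d (e ℕ.+ m) * qbinom e m ≈ d e * d m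
  d-qbinom e m = begin
    d (e ℕ.+ m) * qbinom e m                                                  ≈⟨ *-identityʳ _ ⟨
    (d (e ℕ.+ m) * qbinom e m) * 1#                                           ≈⟨ *-congˡ (trans (*-cong (d-inverse e) (d-inverse m)) (*-identityˡ 1#)) ⟨
    (d (e ℕ.+ m) * qbinom e m) * ((qfact p q e * d e) * (qfact p q m * d m))
      ≈⟨ solve 6 (λ D B Qe De Qm Dm → (D ⊕ B) ⊕ ((Qe ⊕ De) ⊕ (Qm ⊕ Dm)) ⊜ (De ⊕ Dm) ⊕ ((B ⊕ (Qe ⊕ Qm)) ⊕ D)) refl
               (d (e ℕ.+ m)) (qbinom e m) (qfact p q e) (d e) (qfact p q m) (d m) ⟩
    (d e * d m) * ((qbinom e m * (qfact p q e * qfact p q m)) * d (e ℕ.+ m))  ≈⟨ *-congˡ (*-congʳ (qfact-+ e m)) ⟨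
    (d e * d m) * (qfact p q (e ℕ.+ m) * d (e ℕ.+ m))                         ≈⟨ *-congˡ (d-inverse (e ℕ.+ m)) ⟩
    (d e * d m) * 1#                                                          ≈⟨ *-identityʳ _ ⟩
    d e * d m                                                                 ∎

  A N Ê : PS
  A = Aser k Υ j p q r d
  N = Nser k Υ j x p q r d
  Ê e = d e * firstMatchSum e

  A≈ : ∀ n → A n ≈ d n * matchFreeSum n
  A≈ n = *-congˡ (∑-filterᵇ (noMatch Υ j) (weightA p q r) (wreath k n))

  N≈ : ∀ n → N n ≈ d n * packingSum n
  N≈ n = *-congˡ (∑-cong (wreath k n) (λ s → *-comm _ _))

  N-recursion : ∀ n → N n ≈ A n + x * (Ê *PS N) n
  N-recursion n = begin
    N n                                                     ≈⟨ N≈ n ⟩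
    d n * packingSum n                                      ≈⟨ *-congˡ (packingSum-recursion n) ⟩
    d n * (matchFreeSum n + x * ∑< term (suc n))            ≈⟨ distribˡ _ _ _ ⟩
    d n * matchFreeSum n + d n * (x * ∑< term (suc n))      ≈⟨ +-cong (sym (A≈ n)) (x∙yz≈y∙xz _ _ _) ⟩
    A n + x * (d n * ∑< term (suc n))                       ≈⟨ +-congˡ (*-congˡ (trans (*-distribˡ-∑< (d n) term (suc n))
                                                                 (∑<-cong (suc n) (λ e e≤n → normalise e (ℕ.≤-pred e≤n))))) ⟩
    A n + x * ∑< (λ e → Ê e * N (n ∸ e)) (suc n)           ≡⟨ cong (λ t → A n + x * t) (*PS≡∑< Ê N n) ⟨
    A n + x * (Ê *PS N) n                                   ∎
    where
    term : ℕ → Carrier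
    term e = qbinom e (n ∸ e) * (firstMatchSum e * packingSum (n ∸ e))
    normalise : ∀ e → e ≤ n → d n * term e ≈ Ê e * N (n ∸ e)
    normalise e e≤n = begin
      d n * term e                                                      ≈⟨ *-assoc _ _ _ ⟨
      (d n * qbinom e (n ∸ e)) * (firstMatchSum e * packingSum (n ∸ e))
        ≡⟨ cong (λ m → (d m * qbinom e (n ∸ e)) * (firstMatchSum e * packingSum (n ∸ e))) (≡.sym (ℕ.m+[n∸m]≡n e≤n)) ⟩
      (d (e ℕ.+ (n ∸ e)) * qbinom e (n ∸ e)) * (firstMatchSum e * packingSum (n ∸ e))
                                                                        ≈⟨ *-congʳ (d-qbinom e (n ∸ e)) ⟩
      (d e * d (n ∸ e)) * (firstMatchSum e * packingSum (n ∸ e))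
        ≈⟨ solve 4 (λ a b c e → (a ⊕ b) ⊕ (c ⊕ e) ⊜ (a ⊕ c) ⊕ (b ⊕ e)) refl _ _ _ _ ⟩
      Ê e * (d (n ∸ e) * packingSum (n ∸ e))                            ≈⟨ *-congˡ (N≈ (n ∸ e)) ⟨
      Ê e * N (n ∸ e)                                                   ∎

  C E : PS
  C = (constPS (rint r k) *PS tPS) -PS constPS 1#
  E = constPS 1# +PS (C *PS A)

  A-0 : A 0 ≈ 1#
  A-0 = trans (A≈ 0) (trans (*-cong d-0 empty) (*-identityˡ 1#))
    where
    empty : matchFreeSum 0 ≈ 1#
    empty = trans (+-identityʳ _) (trans (*-congʳ (reflexive (cong 𝟙 (⇒matchFree [] [] noWindow))))
                  (trans (*-identityˡ _) (trans (*-identityʳ _) (*-identityˡ _))))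
      where
      noWindow : NoMatchWithin [] [] 0
      noWindow m m+j≤0 = ⊥-elim (ℕ.<⇒≱ 1≤j (ℕ.≤-trans (ℕ.m≤n+m j m) m+j≤0))

  Ê-0 : Ê 0 ≈ 0#
  Ê-0 = trans (*-congˡ (trans (+-identityʳ _) (trans (*-congʳ (reflexive (cong 𝟙 (Bool.∧-inverseʳ (matchFree [] []))))) (zeroˡ _))))
              (zeroʳ _)

  Ê-suc : ∀ e → Ê (suc e) ≈ rint r k * A e - A (suc e)
  Ê-suc e = begin
    d (suc e) * firstMatchSum (suc e)
      ≈⟨ *-congˡ (x+y≈z⇒x≈z-y (firstMatchSum-recursion e)) ⟩
    d (suc e) * (qbinom e 1 * (matchFreeSum e * rint r k) - matchFreeSum (suc e))
      ≈⟨ x[y-z]≈xy-xz _ _ _ ⟩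
    d (suc e) * (qbinom e 1 * (matchFreeSum e * rint r k)) - d (suc e) * matchFreeSum (suc e)
      ≈⟨ +-cong leading (-‿cong (sym (A≈ (suc e)))) ⟩
    rint r k * A e - A (suc e) ∎
    where
    x+y≈z⇒x≈z-y : ∀ {a b c} → a + b ≈ c → a ≈ c - b
    x+y≈z⇒x≈z-y {a} {b} {c} a+b≈c = begin
      a              ≈⟨ +-identityʳ a ⟨
      a + 0#         ≈⟨ +-congˡ (-‿inverseʳ b) ⟨
      a + (b - b)    ≈⟨ +-assoc _ _ _ ⟨
      (a + b) - b    ≈⟨ +-congʳ a+b≈c ⟩
      c - b          ∎
    leading : d (suc e) * (qbinom e 1 * (matchFreeSum e * rint r k)) ≈ rint r k * A e
    leading = begin
      d (suc e) * (qbinom e 1 * (matchFreeSum e * rint r k))     ≈⟨ *-assoc _ _ _ ⟨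
      (d (suc e) * qbinom e 1) * (matchFreeSum e * rint r k)     ≡⟨ cong (λ m → (d m * qbinom e 1) * (matchFreeSum e * rint r k)) (ℕ.+-comm 1 e) ⟩
      (d (e ℕ.+ 1) * qbinom e 1) * (matchFreeSum e * rint r k)   ≈⟨ *-congʳ (trans (d-qbinom e 1) (trans (*-congˡ d-1) (*-identityʳ _))) ⟩
      d e * (matchFreeSum e * rint r k)                          ≈⟨ *-assoc _ _ _ ⟨
      (d e * matchFreeSum e) * rint r k                          ≈⟨ *-comm _ _ ⟩
      rint r k * (d e * matchFreeSum e)                          ≈⟨ *-congˡ (A≈ e) ⟨
      rint r k * A e                                             ∎

  C-0 : C 0 ≈ - 1#
  C-0 = trans (+-congʳ (trans (+-identityʳ _) (zeroʳ _))) (+-identityˡ _)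

  C-1 : C 1 ≈ rint r k
  C-1 = trans (+-cong (trans (+-congˡ (trans (+-identityʳ _) (zeroˡ _))) (trans (+-identityʳ _) (*-identityʳ _))) -0#≈0#)
              (+-identityʳ _)

  C-2+ : ∀ i → C (suc (suc i)) ≈ 0#
  C-2+ i = trans (+-cong (trans (reflexive (*PS≡∑< (constPS (rint r k)) tPS (suc (suc i))))
                                (∑<-zero _ (suc (suc (suc i))) vanish)) -0#≈0#) (+-identityʳ 0#)
    where
    vanish : ∀ l → l < suc (suc (suc i)) → constPS (rint r k) l * tPS (suc (suc i) ∸ l) ≈ 0#
    vanish zero    _ = zeroʳ _
    vanish (suc l) _ = zeroˡ _

  Ê≈E : Ê ≈PS E
  Ê≈E zero = begin
    Ê 0                        ≈⟨ Ê-0 ⟩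
    0#                         ≈⟨ -‿inverseʳ 1# ⟨
    1# - 1#                    ≈⟨ +-congˡ (trans (sym (*-identityʳ _)) (*-cong (sym C-0) (sym A-0))) ⟩
    1# + C 0 * A 0             ≈⟨ +-congˡ (+-identityʳ _) ⟨
    E 0                        ∎
  Ê≈E (suc e) = begin
    Ê (suc e)                                                        ≈⟨ Ê-suc e ⟩
    rint r k * A e - A (suc e)                                       ≈⟨ +-comm _ _ ⟩
    - A (suc e) + rint r k * A e                                     ≈⟨ +-cong (trans (sym (-1*x≈-x _)) (*-congʳ (sym C-0)))
                                                                               (trans (*-congʳ (sym C-1)) (sym (+-identityʳ _))) ⟩
    C 0 * A (suc e) + (C 1 * A e + 0#)                                ≈⟨ +-congˡ (+-congˡ (∑<-zero _ e (λ i _ → trans (*-congʳ (C-2+ i)) (zeroˡ _)))) ⟨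
    C 0 * A (suc e) + (C 1 * A e + ∑< (λ i → C (suc (suc i)) * A (e ∸ suc i)) e)
                                                                     ≡⟨ *PS≡∑< C A (suc e) ⟨
    (C *PS A) (suc e)                                                ≈⟨ +-identityˡ _ ⟨
    E (suc e)                                                        ∎

  N*D≈A : (N *PS (constPS 1# -PS (constPS x *PS E))) ≈PS A
  N*D≈A = F≈A+aEF⇒F[1-aE]≈A x E N A (λ n → trans (N-recursion n) (+-congˡ (*-congˡ (*PS-cong {G = N} {G′ = N} Ê≈E (λ _ → refl) n))))

theorem10 : {c ℓ : Level} (R : CommutativeRing c ℓ) →
    (k j : ℕ) → 2 ≤ k → 1 ≤ j →
    (Υ : Pattern) → ValidPattern k j Υ →
    (x p q r : CommutativeRing.Carrier R) →
    (d : ℕ → CommutativeRing.Carrier R) →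
    (∀ n → CommutativeRing._≈_ R (CommutativeRing._*_ R (Series.qfact R p q n) (d n)) (CommutativeRing.1# R)) →
    let open CommutativeRing R
        open Series R
        N = Nser k Υ j x p q r d
        A = Aser k Υ j p q r d
        D = constPS 1# -PS (constPS x *PS (constPS 1# +PS (((constPS (rint r k) *PS tPS) -PS constPS 1#) *PS A)))
    in (N *PS D) ≈PS A
theorem10 R k j _ 1≤j Υ _ x p q r d d-inverse = GeneratingFunction.N*D≈A R k j 1≤j Υ x p q r d d-inverse
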